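{- Let $0\le\alpha<\frac14$. Then there exists a set $A\subset\mathbb{N}$ having Buck density $\mu(A)=\alpha$ and such that $\underline{\mu}(A+A)\neq\overline{\mu}(A+A)$.
   Context: $\mathbb{N}=\{0,1,2,\dots\}$; $A+A=\{a+b:a,b\in A\}$. Let $\mathcal{Z}$ be the family of all finite unions $\bigcup_{i=1}^r(a_i+k_i\mathbb{N})$ with $r,a_i,k_i\in\mathbb{N}$; each $B\in\mathcal{Z}$ has a natural density $d(B)=\lim_{n\to\infty}|B\cap[1,n]|/n$. For $X\subset\mathbb{N}$, the upper Buck density is $\overline{\mu}(X)=\inf\{d(B): X\subset B\in\mathcal{Z}\}$ and the lower Buck density is $\underline{\mu}(X)=\sup\{d(B): X\supset B\in\mathcal{Z}\}$ $(=1-\overline{\mu}(\mathbb{N}\setminus X))$. If they coincide, $X$ has Buck density $\mu(X)$ equal to the common value. -}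

module Defs where

open import Level using (Level; 0ℓ)
open import Data.Nat as ℕ using (ℕ; zero; suc; _+_; _*_)
open import Data.Nat.Properties as ℕP using (m≤m+n; m≤n+m; ≤-trans)
import Data.Fin
open import Data.Fin using (Fin; toℕ; fromℕ<)
open import Data.Fin.Properties using (any?; toℕ-fromℕ<)
open import Data.Integer using (+_)
open import Data.Rational as ℚ using (ℚ; _<_; _-_; ∣_∣; 0ℚ)
open import Data.List using (List)
open import Data.List.Relation.Unary.Any as Any using (Any)
open import Data.Product using (Σ; ∃; _×_; _,_)
open import Data.Sum using (_⊎_)
open import Relation.Nullary using (Dec; yes; no; ¬_)
open import Relation.Nullary.Decidable as Dec using (map′)
open import Relation.Binary.PropositionalEquality using (_≡_; refl; subst; sym; trans; cong)
open import Function.Bundles using (_⇔_)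

SubsetNat : Set₁
SubsetNat = ℕ → Set

_⊆_ : SubsetNat → SubsetNat → Set
X ⊆ Y = ∀ n → X n → Y n

_⊕_ : SubsetNat → SubsetNat → SubsetNat
(A ⊕ B) n = Σ ℕ λ a → Σ ℕ λ b → A a × B b × (a + b ≡ n)

-- The family 𝒵: a code is a finite list of pairs (a_i , k_i); it denotes
-- ⋃_i (a_i + k_i ℕ).  (r = 0, i.e. the empty list, gives ∅.)

ZCode : Set
ZCode = List (ℕ × ℕ)

InAP : ℕ × ℕ → ℕ → Set
InAP (a , k) n = Σ ℕ λ m → n ≡ a + k * m

⟦_⟧ : ZCode → SubsetNat
⟦ c ⟧ n = Any (λ p → InAP p n) c

-- helper: membership in an arithmetic progression is decidable
-- (the witness can be bounded by n)
inAP? : ∀ p n → Dec (InAP p n)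
inAP? (a , zero) n = map′ (λ eq → 0 , eq) (λ { (_ , eq) → eq }) (n ℕ.≟ a + 0)
inAP? (a , suc k) n = map′ to from (any? λ (i : Fin (suc n)) → n ℕ.≟ a + suc k * toℕ i)
  where
  to : ∃ (λ (i : Fin (suc n)) → n ≡ a + suc k * toℕ i) → InAP (a , suc k) n
  to (i , eq) = toℕ i , eq
  from : InAP (a , suc k) n → ∃ (λ (i : Fin (suc n)) → n ≡ a + suc k * toℕ i)
  from (m , eq) = fromℕ< m<sn , subst (λ x → n ≡ a + suc k * x) (sym (toℕ-fromℕ< m<sn)) eq
    where
    m<sn : m ℕ.< suc n
    m<sn = ℕ.s≤s (subst (m ℕ.≤_) (sym eq)
             (≤-trans (m≤m+n m (k * m)) (m≤n+m (m + k * m) a)))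

⟦_⟧? : ∀ c n → Dec (⟦ c ⟧ n)
⟦ c ⟧? n = Any.any? (λ p → inAP? p n) c

count : (B : SubsetNat) → (∀ n → Dec (B n)) → ℕ → ℕ
count B B? zero = zero
count B B? (suc n) with B? (suc n)
... | yes _ = suc (count B B? n)
... | no  _ = count B B? n

HasDensity : (B : SubsetNat) → (∀ n → Dec (B n)) → ℚ → Set
HasDensity B B? q =
  ∀ (ε : ℚ) → 0ℚ < ε → Σ ℕ λ N → ∀ n → N ℕ.≤ n →
    ∣ (+ count B B? (suc n)) ℚ./ suc n - q ∣ < ε

ZDensity : ZCode → ℚ → Set
ZDensity c q = HasDensity ⟦ c ⟧ ⟦ c ⟧? q

record ℝ : Set₁ where
  field
    L U        : ℚ → Set
    L-inhabited : ∃ L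
    U-inhabited : ∃ U
    L-lower    : ∀ {p q} → p < q → L q → L p
    U-upper    : ∀ {p q} → p < q → U p → U q
    L-open     : ∀ {q} → L q → ∃ λ r → q < r × L r
    U-open     : ∀ {q} → U q → ∃ λ r → r < q × U r
    disjoint   : ∀ {q} → ¬ (L q × U q)
    located    : ∀ {p q} → p < q → L p ⊎ U q
open ℝ public

_<ℝ_ : ℚ → ℝ → Set
q <ℝ x = L x q
_ℝ<_ : ℝ → ℚ → Set
x ℝ< q = U x q
_ℝ≤_ : ℝ → ℚ → Set
x ℝ≤ q = ¬ (L x q)
_≤ℝ_ : ℚ → ℝ → Set
q ≤ℝ x = ¬ (U x q)

_≈ℝ_ : ℝ → ℝ → Set
x ≈ℝ y = (∀ q → L x q ⇔ L y q) × (∀ q → U x q ⇔ U y q)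

-- upper Buck density of X is β:  β = inf { d(B) : X ⊆ B ∈ 𝒵 }
IsUpperBuck : SubsetNat → ℝ → Set
IsUpperBuck X β =
  (∀ (c : ZCode) (q : ℚ) → X ⊆ ⟦ c ⟧ → ZDensity c q → β ℝ≤ q)
  × (∀ (r : ℚ) → β ℝ< r →
       Σ ZCode λ c → Σ ℚ λ q → X ⊆ ⟦ c ⟧ × ZDensity c q × q < r)

-- lower Buck density of X is β:  β = sup { d(B) : X ⊇ B ∈ 𝒵 }
IsLowerBuck : SubsetNat → ℝ → Set
IsLowerBuck X β =
  (∀ (c : ZCode) (q : ℚ) → ⟦ c ⟧ ⊆ X → ZDensity c q → q ≤ℝ β)
  × (∀ (r : ℚ) → r <ℝ β →
       Σ ZCode λ c → Σ ℚ λ q → ⟦ c ⟧ ⊆ X × ZDensity c q × r < q)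

HasBuckDensity : SubsetNat → ℝ → Set
HasBuckDensity X β = IsUpperBuck X β × IsLowerBuck X β

-- The set is A = 3V ∪ 3E ∪ 6E ∪ (1 + 3E) ∪ (1 + 3Q), where E is the Moser–de Bruijn set of sums
-- of distinct powers of 4, Q = {4^(3k) + 2e : e ∈ E, 2e < 4^k}, and V = {m : vdC(m) < 3α} for the
-- van der Corput sequence vdC.
--
-- Since E + 2E = ℕ, A + A contains every n ≢ 2 (mod 3), and (1 + 3E) + (1 + 3Q) fills the blocks
-- 2 + 3(4^(3k) + [0, 4^k)).  These blocks meet every infinite progression, so a set of 𝒵 containing
-- A + A contains a tail of ℕ: the upper Buck density of A + A is 1.  But the elements of E ∪ Q below
-- 4^(3k+3) are below a third of it, so 2 + 3y ∉ A + A for 3·4^(3k+2) ≤ y < 4^(3k+3).  Every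
-- progression inside 2 + 3ℕ meets such a gap, so a set of 𝒵 inside A + A lies in 3ℕ ∪ (1 + 3ℕ) up
-- to finitely many points: the lower Buck density of A + A is 2/3.
--
-- Modulo 4^i, V is squeezed between unions of classes.  Let rev reverse the lowest 2i binary
-- digits, which permutes the classes.  If the grid point I/(3·4^i) lies above α, every m ∈ V has
-- rev(m) < I; if it lies below α, every m with rev(m) < I is in V.  The rest of A occupies at most
-- 4·2^i classes plus finitely many points, so A has Buck density α.  The bound α < 1/4 keeps the
-- inner grid point below 1/3, that is I ≤ 4^i.

module Submission where

open import Defs
open import Data.Nat using (ℕ; zero; suc; pred; _+_; _*_; _∸_; _^_; _≤_; _<_; _≤?_; z≤n; s≤s; NonZero; >-nonZero; ⌊_/2⌋)
open import Data.Nat.Properties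
open import Data.Nat.DivMod using (_%_; m≡m%n+[m/n]*n; m%n<n; [m+kn]%n≡m%n; m<n⇒m%n≡m) renaming (_/_ to _div_)
open import Data.Nat.Solver using (module +-*-Solver)
open import Data.Integer as ℤ using (ℤ; +_; -[1+_]; _⊖_)
import Data.Integer.Properties as ℤP
open import Data.Rational as ℚ using (ℚ; mkℚ; _/_; 0ℚ; 1ℚ; toℚᵘ)
import Data.Rational.Properties as ℚP
open import Data.Rational.Solver renaming (module +-*-Solver to ℚ-Solver)
open import Data.Rational.Unnormalised as ℚᵘ using (mkℚᵘ; *<*; *≤*)
import Data.Rational.Unnormalised.Properties as ℚᵘP
open import Data.List using (List; []; _∷_; map; length; _++_; applyDownFrom; downFrom)
open import Data.List.Properties using (length-++; length-map; length-applyDownFrom)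
open import Data.List.Relation.Unary.All as All using (All; []; _∷_)
import Data.List.Relation.Unary.All.Properties as Allₚ
open import Data.List.Relation.Unary.AllPairs as AllPairs using (AllPairs; []; _∷_)
import Data.List.Relation.Unary.AllPairs.Properties as AllPairsₚ
open import Data.List.Relation.Unary.Any as Any using (Any; here; there; toSum)
import Data.List.Relation.Unary.Any.Properties as Anyₚ
open import Data.Product using (Σ; ∃; _×_; _,_; proj₁; proj₂)
open import Data.Sum using (_⊎_; inj₁; inj₂)
open import Data.Empty using (⊥-elim)
open import Function using (_∘_)
open import Function.Bundles using (Equivalence)
open import Relation.Nullary using (Dec; yes; no; ¬_)
open import Relation.Unary using (Decidable)
open import Relation.Binary.PropositionalEquality
open import Relation.Binary.Definitions using (tri<; tri≈; tri>)

module _ {B : SubsetNat} (B? : Decidable B) where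

  count-≤ : ∀ n → count B B? n ≤ n
  count-≤ zero = z≤n
  count-≤ (suc n) with B? (suc n)
  ... | yes _ = s≤s (count-≤ n)
  ... | no  _ = m≤n⇒m≤1+n (count-≤ n)

  count-≡0 : ∀ N → (∀ n → 1 ≤ n → n ≤ N → ¬ B n) → count B B? N ≡ 0
  count-≡0 zero    _  = refl
  count-≡0 (suc N) ∉B with B? (suc N)
  ... | yes b = ⊥-elim (∉B (suc N) (s≤s z≤n) ≤-refl b)
  ... | no  _ = count-≡0 N (λ n 1≤n n≤N → ∉B n 1≤n (m≤n⇒m≤1+n n≤N))

  count-≡1 : ∀ N c → 1 ≤ c → c ≤ N → B c → (∀ n → 1 ≤ n → n ≤ N → B n → n ≡ c) →
             count B B? N ≡ 1
  count-≡1 zero    _ () z≤n _ _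
  count-≡1 (suc N) c 1≤c c≤1+N Bc unique with B? (suc N)
  ... | yes b = cong suc (count-≡0 N λ n 1≤n n≤N Bn →
                  <-irrefl (trans (unique n 1≤n (m≤n⇒m≤1+n n≤N) Bn) (sym (unique (suc N) (s≤s z≤n) ≤-refl b)))
                           (s≤s n≤N))
  ... | no ¬b with m≤n⇒m<n∨m≡n c≤1+N
  ...   | inj₂ refl = ⊥-elim (¬b Bc)
  ...   | inj₁ c≤N  = count-≡1 N c 1≤c (≤-pred c≤N) Bc (λ n 1≤n n≤N → unique n 1≤n (m≤n⇒m≤1+n n≤N))

  count-periodic : ∀ K → (∀ {n} → B n → B (n + K)) → (∀ {n} → B (n + K) → B n) →
                   ∀ n → count B B? (n + K) ≡ count B B? n + count B B? K
  count-periodic K fwd bwd zero = refl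
  count-periodic K fwd bwd (suc n) with B? (suc (n + K)) | B? (suc n)
  ... | yes _ | yes _  = cong suc (count-periodic K fwd bwd n)
  ... | yes b | no ¬b  = ⊥-elim (¬b (bwd b))
  ... | no ¬b | yes b  = ⊥-elim (¬b (fwd b))
  ... | no _  | no _   = count-periodic K fwd bwd n

module _ {B C : SubsetNat} (B? : Decidable B) (C? : Decidable C) where

  count-mono : B ⊆ C → ∀ n → count B B? n ≤ count C C? n
  count-mono B⊆C zero = z≤n
  count-mono B⊆C (suc n) with B? (suc n) | C? (suc n)
  ... | yes _ | yes _  = s≤s (count-mono B⊆C n)
  ... | yes b | no ¬c  = ⊥-elim (¬c (B⊆C _ b))
  ... | no _  | yes _  = m≤n⇒m≤1+n (count-mono B⊆C n)
  ... | no _  | no _   = count-mono B⊆C n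

  count-mono-from : ∀ N → (∀ n → N ≤ n → B n → C n) → ∀ n → count B B? n ≤ count C C? n + N
  count-mono-from N B⊆C zero = z≤n
  count-mono-from N B⊆C (suc n) with N ≤? suc n
  ... | no N≰ = ≤-trans (count-≤ B? (suc n)) (≤-trans (<⇒≤ (≰⇒> N≰)) (m≤n+m N _))
  ... | yes N≤ with B? (suc n) | C? (suc n)
  ...   | yes _ | yes _ = s≤s (count-mono-from N B⊆C n)
  ...   | yes b | no ¬c = ⊥-elim (¬c (B⊆C _ N≤ b))
  ...   | no _  | yes _ = m≤n⇒m≤1+n (count-mono-from N B⊆C n)
  ...   | no _  | no _  = count-mono-from N B⊆C n

module _ {B C D : SubsetNat} (B? : Decidable B) (C? : Decidable C) (D? : Decidable D)
         (D⊆B∪C : ∀ n → D n → B n ⊎ C n) where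

  count-∪-≤ : ∀ n → count D D? n ≤ count B B? n + count C C? n
  count-∪-≤ zero = z≤n
  count-∪-≤ (suc n) with D? (suc n) | B? (suc n) | C? (suc n) | count-∪-≤ n
  ... | no _  | no _  | no _  | ih = ih
  ... | no _  | yes _ | no _  | ih = m≤n⇒m≤1+n ih
  ... | no _  | no _  | yes _ | ih = ≤-trans ih (+-monoʳ-≤ _ (n≤1+n _))
  ... | no _  | yes _ | yes _ | ih = ≤-trans ih (+-mono-≤ (n≤1+n _) (n≤1+n _))
  ... | yes _ | yes _ | no _  | ih = s≤s ih
  ... | yes _ | no _  | yes _ | ih = ≤-trans (s≤s ih) (≤-reflexive (sym (+-suc _ _)))
  ... | yes _ | yes _ | yes _ | ih = s≤s (≤-trans ih (+-monoʳ-≤ _ (n≤1+n _)))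
  ... | yes d | no ¬b | no ¬c | _ with D⊆B∪C _ d
  ...   | inj₁ b = ⊥-elim (¬b b)
  ...   | inj₂ c = ⊥-elim (¬c c)

  count-∪-disjoint : B ⊆ D → C ⊆ D → (∀ n → B n → ¬ C n) →
                     ∀ n → count D D? n ≡ count B B? n + count C C? n
  count-∪-disjoint B⊆D C⊆D B∩C=∅ zero = refl
  count-∪-disjoint B⊆D C⊆D B∩C=∅ (suc n)
    with D? (suc n) | B? (suc n) | C? (suc n) | count-∪-disjoint B⊆D C⊆D B∩C=∅ n
  ... | _     | yes b | yes c | _  = ⊥-elim (B∩C=∅ _ b c)
  ... | yes _ | yes _ | no _  | ih = cong suc ih
  ... | yes _ | no _  | yes _ | ih = trans (cong suc ih) (sym (+-suc _ _))
  ... | no ¬d | yes b | no _  | _  = ⊥-elim (¬d (B⊆D _ b))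
  ... | no ¬d | no _  | yes c | _  = ⊥-elim (¬d (C⊆D _ c))
  ... | no _  | no _  | no _  | ih = ih
  ... | yes d | no ¬b | no ¬c | _ with D⊆B∪C _ d
  ...   | inj₁ b = ⊥-elim (¬b b)
  ...   | inj₂ c = ⊥-elim (¬c c)

toℚᵘ-/ : ∀ a d .{{_ : NonZero d}} → toℚᵘ ((+ a) / d) ℚᵘ.≃ mkℚᵘ (+ a) (pred d)
toℚᵘ-/ a (suc d) = ℚP.toℚᵘ-fromℚᵘ (mkℚᵘ (+ a) d)

fraction-<⁺ : ∀ a b d e .{{_ : NonZero d}} .{{_ : NonZero e}} → a * e < b * d → (+ a) / d ℚ.< (+ b) / e
fraction-<⁺ a b d@(suc _) e@(suc _) h = ℚP.toℚᵘ-cancel-<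
  (ℚᵘP.<-respʳ-≃ (ℚᵘP.≃-sym (toℚᵘ-/ b e)) (ℚᵘP.<-respˡ-≃ (ℚᵘP.≃-sym (toℚᵘ-/ a d))
    (*<* (subst₂ ℤ._<_ (ℤP.pos-* a e) (ℤP.pos-* b d) (ℤ.+<+ h)))))

fraction-<⁻ : ∀ a b d e .{{_ : NonZero d}} .{{_ : NonZero e}} → (+ a) / d ℚ.< (+ b) / e → a * e < b * d
fraction-<⁻ a b d@(suc _) e@(suc _) h with ℚᵘP.<-respʳ-≃ (toℚᵘ-/ b e) (ℚᵘP.<-respˡ-≃ (toℚᵘ-/ a d) (ℚP.toℚᵘ-mono-< h))
... | *<* h′ = ℤP.drop‿+<+ (subst₂ ℤ._<_ (sym (ℤP.pos-* a e)) (sym (ℤP.pos-* b d)) h′)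

fraction-≤⁺ : ∀ a b d e .{{_ : NonZero d}} .{{_ : NonZero e}} → a * e ≤ b * d → (+ a) / d ℚ.≤ (+ b) / e
fraction-≤⁺ a b d@(suc _) e@(suc _) h = ℚP.toℚᵘ-cancel-≤
  (ℚᵘP.≤-respʳ-≃ (ℚᵘP.≃-sym (toℚᵘ-/ b e)) (ℚᵘP.≤-respˡ-≃ (ℚᵘP.≃-sym (toℚᵘ-/ a d))
    (*≤* (subst₂ ℤ._≤_ (ℤP.pos-* a e) (ℤP.pos-* b d) (ℤ.+≤+ h)))))

nonNegative⇒fraction : ∀ p → ¬ p ℚ.< 0ℚ → Σ ℕ λ n → Σ ℕ λ d → p ≡ (+ n) / suc d
nonNegative⇒fraction p@(mkℚ (+ n) d _) _ = n , d , sym (ℚP.↥p/↧p≡p p)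
nonNegative⇒fraction p@(mkℚ -[1+ n ] d _) p≮0 = ⊥-elim (p≮0 (ℚP.negative⁻¹ p))

∣fraction-fraction∣ : ∀ a b d e .{{_ : NonZero d}} .{{_ : NonZero e}} →
  ℚ.∣ (+ a) / d ℚ.- (+ b) / e ∣ ≡ ((+ ℤ.∣ a * e ⊖ b * d ∣) / (d * e)) {{m*n≢0 d e}}
∣fraction-fraction∣ a b d@(suc _) e@(suc _) = ℚP.toℚᵘ-injective
  (ℚᵘP.≃-trans (ℚP.toℚᵘ-homo-∣-∣ (x ℚ.- y))
  (ℚᵘP.≃-trans (ℚᵘP.∣-∣-cong (ℚᵘP.≃-trans (ℚP.toℚᵘ-homo-+ x (ℚ.- y))
                 (ℚᵘP.+-cong (toℚᵘ-/ a d) (ℚᵘP.≃-trans (ℚP.toℚᵘ-homo‿- y) (ℚᵘP.-‿cong (toℚᵘ-/ b e))))))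
  (ℚᵘP.≃-trans (ℚᵘP.≃-reflexive (cong (λ z → mkℚᵘ (+ ℤ.∣ z ∣) (pred (d * e))) numerator))
  (ℚᵘP.≃-sym (toℚᵘ-/ (ℤ.∣ a * e ⊖ b * d ∣) (d * e))))))
  where
  x = (+ a) / d
  y = (+ b) / e
  numerator : + a ℤ.* + e ℤ.+ ℤ.- (+ b) ℤ.* + d ≡ a * e ⊖ b * d
  numerator = trans (cong₂ ℤ._+_ (sym (ℤP.pos-* a e))
                      (trans (sym (ℤP.neg-distribˡ-* (+ b) (+ d))) (cong ℤ.-_ (sym (ℤP.pos-* b d)))))
                    (ℤP.m-n≡m⊖n (a * e) (b * d))

∣⊖∣-≤ : ∀ a b C → a ≤ b + C → b ≤ a + C → ℤ.∣ a ⊖ b ∣ ≤ C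
∣⊖∣-≤ a b C a≤b+C b≤a+C with ≤-total a b
... | inj₁ a≤b = subst (_≤ C) (sym (ℤP.∣⊖∣-≤ a≤b)) (m≤n+o⇒m∸n≤o b a b≤a+C)
... | inj₂ b≤a = subst (_≤ C) (sym (trans (ℤP.∣m⊖n∣≡∣n⊖m∣ a b) (ℤP.∣⊖∣-≤ b≤a))) (m≤n+o⇒m∸n≤o a b a≤b+C)

module _ {S : SubsetNat} (S? : Decidable S) (K : ℕ) .{{_ : NonZero K}} (W C : ℕ)
         (upper : ∀ n → K * count S S? n ≤ W * n + C) (lower : ∀ n → W * n ≤ K * count S S? n + C) where

  discrepancy-bound : ∀ m e → 0 < m → ∀ n → C * suc e ≤ n →
                      ℚ.∣ (+ count S S? (suc n)) / suc n ℚ.- (+ W) / K ∣ ℚ.< (+ m) / suc e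
  discrepancy-bound m e 0<m n C[1+e]≤n = subst (ℚ._< (+ m) / suc e) (sym (∣fraction-fraction∣ c W (suc n) K))
    (fraction-<⁺ (ℤ.∣ c * K ⊖ W * suc n ∣) m (suc n * K) (suc e) {{m*n≢0 (suc n) K}} bound)
    where
    c = count S S? (suc n)
    bound : ℤ.∣ c * K ⊖ W * suc n ∣ * suc e < m * (suc n * K)
    bound = begin-strict
      ℤ.∣ c * K ⊖ W * suc n ∣ * suc e ≤⟨ *-monoˡ-≤ (suc e) (∣⊖∣-≤ (c * K) (W * suc n) C
                                           (subst (_≤ W * suc n + C) (*-comm K c) (upper (suc n)))
                                           (subst (λ x → W * suc n ≤ x + C) (*-comm K c) (lower (suc n)))) ⟩
      C * suc e                        ≤⟨ C[1+e]≤n ⟩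
      n                                <⟨ n<1+n n ⟩
      suc n                            ≤⟨ m≤m*n (suc n) K ⟩
      suc n * K                        ≤⟨ m≤n*m (suc n * K) m {{>-nonZero 0<m}} ⟩
      m * (suc n * K)                  ∎
      where open ≤-Reasoning

  density-from-discrepancy : HasDensity S S? ((+ W) / K)
  density-from-discrepancy ε 0<ε =
    let m , e , ε≡m/e = nonNegative⇒fraction ε (ℚP.<-asym 0<ε)
        0<m = subst (0 <_) (*-identityʳ m) (fraction-<⁻ 0 m 1 (suc e) (subst (0ℚ ℚ.<_) ε≡m/e 0<ε))
    in  C * suc e , λ n C[1+e]≤n → subst (_ ℚ.<_) (sym ε≡m/e) (discrepancy-bound m e 0<m n C[1+e]≤n)

p≤∣p∣ : ∀ p → p ℚ.≤ ℚ.∣ p ∣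
p≤∣p∣ p with ℚP.∣p∣≡p∨∣p∣≡-p p
... | inj₁ ∣p∣≡p  = ℚP.≤-reflexive (sym ∣p∣≡p)
... | inj₂ ∣p∣≡-p = ℚP.≤-trans p≤0 (ℚP.0≤∣p∣ p)
  where
  open ℚ-Solver
  p≤0 : p ℚ.≤ 0ℚ
  p≤0 = subst₂ ℚ._≤_ (solve 1 (λ p → :- (:- p) := p) refl p) refl
          (ℚP.neg-antimono-≤ (subst (0ℚ ℚ.≤_) ∣p∣≡-p (ℚP.0≤∣p∣ p)))

module _ {x p ε : ℚ} (close : ℚ.∣ x ℚ.- p ∣ ℚ.< ε) where
  open ℚ-Solver

  ∣x-p∣<ε⇒x<p+ε : x ℚ.< p ℚ.+ ε
  ∣x-p∣<ε⇒x<p+ε = subst₂ ℚ._<_ (solve 2 (λ x p → (x :- p) :+ p := x) refl x p) (ℚP.+-comm ε p)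
             (ℚP.+-monoˡ-< p (ℚP.≤-<-trans (p≤∣p∣ (x ℚ.- p)) close))

  ∣x-p∣<ε⇒p-ε<x : p ℚ.- ε ℚ.< x
  ∣x-p∣<ε⇒p-ε<x = subst₂ ℚ._<_ (solve 3 (λ x p ε → :- (x :- p) :+ (x :- ε) := p :- ε) refl x p ε)
                        (solve 2 (λ x ε → ε :+ (x :- ε) := x) refl x ε)
             (ℚP.+-monoˡ-< (x ℚ.- ε) (ℚP.≤-<-trans (p≤∣p∣ (ℚ.- (x ℚ.- p))) (subst (ℚ._< ε) (sym (ℚP.∣-p∣≡∣p∣ _)) close)))

p<q⇒0<q-p : ∀ {a b} → a ℚ.< b → 0ℚ ℚ.< b ℚ.- a
p<q⇒0<q-p {a} {b} a<b = subst (ℚ._< b ℚ.- a) (ℚP.+-inverseʳ a) (ℚP.+-monoˡ-< (ℚ.- a) a<b)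

separated : ∀ {x p y q m} → ℚ.∣ x ℚ.- p ∣ ℚ.< p ℚ.- m → ℚ.∣ y ℚ.- q ∣ ℚ.< m ℚ.- q → y ℚ.< x
separated {x} {p} {y} {q} {m} x≈p y≈q = begin-strict
  y                <⟨ ∣x-p∣<ε⇒x<p+ε y≈q ⟩
  q ℚ.+ (m ℚ.- q)  ≡⟨ solve 2 (λ q m → q :+ (m :- q) := m) refl q m ⟩
  m                ≡⟨ solve 2 (λ p m → m := p :- (p :- m)) refl p m ⟩
  p ℚ.- (p ℚ.- m)  <⟨ ∣x-p∣<ε⇒p-ε<x x≈p ⟩
  x                ∎
  where
  open ℚP.≤-Reasoning
  open ℚ-Solver

density-mono : ∀ {B C : SubsetNat} (B? : Decidable B) (C? : Decidable C) {p q} → B ⊆ C →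
               HasDensity B B? p → HasDensity C C? q → ¬ q ℚ.< p
density-mono {B} {C} B? C? {p} {q} B⊆C dB dC q<p =
  let m , q<m , m<p = ℚP.<-dense q<p
      NB , B≈p = dB (p ℚ.- m) (p<q⇒0<q-p m<p)
      NC , C≈q = dC (m ℚ.- q) (p<q⇒0<q-p q<m)
      n = NB + NC
  in  ℚP.<-irrefl refl (ℚP.<-≤-trans (separated (B≈p n (m≤m+n NB NC)) (C≈q n (m≤n+m NC NB)))
        (fraction-≤⁺ (count B B? (suc n)) (count C C? (suc n)) (suc n) (suc n)
          (*-monoˡ-≤ (suc n) (count-mono B? C? B⊆C (suc n)))))

open +-*-Solver using (solve; _:+_; _:*_; _:=_; con)

module Periodic {P : SubsetNat} (P? : Decidable P) (K : ℕ) .{{_ : NonZero K}}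
                (P-+K : ∀ {n} → P n → P (n + K)) (P-∸K : ∀ {n} → P (n + K) → P n) where

  private
    c = count P P?
    W = count P P? K

  count-periods : ∀ t j → c (j + t * K) ≡ c j + t * W
  count-periods zero    j = trans (cong c (+-identityʳ j)) (sym (+-identityʳ (c j)))
  count-periods (suc t) j = begin
    c (j + (K + t * K))  ≡⟨ cong c (trans (cong (_+_ j) (+-comm K (t * K))) (sym (+-assoc j (t * K) K))) ⟩
    c (j + t * K + K)    ≡⟨ count-periodic P? K P-+K P-∸K (j + t * K) ⟩
    c (j + t * K) + W    ≡⟨ cong (_+ W) (count-periods t j) ⟩
    c j + t * W + W      ≡⟨ trans (+-assoc (c j) (t * W) W) (cong (_+_ (c j)) (+-comm (t * W) W)) ⟩
    c j + (W + t * W)    ∎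
    where open ≡-Reasoning

  private
    j t : ℕ → ℕ
    j n = n % K
    t n = n div K
    K*tW≡W*tK : ∀ n → K * (t n * W) ≡ W * (t n * K)
    K*tW≡W*tK n = trans (sym (*-assoc K (t n) W)) (trans (cong (_* W) (*-comm K (t n))) (*-comm (t n * K) W))

  count-discrepancyˡ : ∀ n → K * c n ≤ W * n + K * K
  count-discrepancyˡ n = begin
    K * c n                    ≡⟨ cong (λ x → K * c x) (m≡m%n+[m/n]*n n K) ⟩
    K * c (j n + t n * K)      ≡⟨ cong (K *_) (count-periods (t n) (j n)) ⟩
    K * (c (j n) + t n * W)    ≡⟨ *-distribˡ-+ K (c (j n)) (t n * W) ⟩
    K * c (j n) + K * (t n * W) ≤⟨ +-mono-≤ (*-monoʳ-≤ K (≤-trans (count-≤ P? (j n)) (<⇒≤ (m%n<n n K))))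
                                            (≤-reflexive (K*tW≡W*tK n)) ⟩
    K * K + W * (t n * K)      ≤⟨ +-monoʳ-≤ (K * K) (*-monoʳ-≤ W (m≤n+m (t n * K) (j n))) ⟩
    K * K + W * (j n + t n * K) ≡⟨ cong (λ x → K * K + W * x) (sym (m≡m%n+[m/n]*n n K)) ⟩
    K * K + W * n              ≡⟨ +-comm (K * K) (W * n) ⟩
    W * n + K * K              ∎
    where open ≤-Reasoning

  count-discrepancyʳ : ∀ n → W * n ≤ K * c n + K * K
  count-discrepancyʳ n = begin
    W * n                      ≡⟨ cong (W *_) (m≡m%n+[m/n]*n n K) ⟩
    W * (j n + t n * K)        ≡⟨ *-distribˡ-+ W (j n) (t n * K) ⟩
    W * j n + W * (t n * K)    ≤⟨ +-mono-≤ (*-mono-≤ (count-≤ P? K) (<⇒≤ (m%n<n n K))) (≤-reflexive (sym (K*tW≡W*tK n))) ⟩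
    K * K + K * (t n * W)      ≤⟨ +-monoʳ-≤ (K * K) (*-monoʳ-≤ K (m≤n+m (t n * W) (c (j n)))) ⟩
    K * K + K * (c (j n) + t n * W) ≡⟨ cong (λ x → K * K + K * x) (sym (count-periods (t n) (j n))) ⟩
    K * K + K * c (j n + t n * K) ≡⟨ cong (λ x → K * K + K * c x) (sym (m≡m%n+[m/n]*n n K)) ⟩
    K * K + K * c n            ≡⟨ +-comm (K * K) (K * c n) ⟩
    K * c n + K * K            ∎
    where open ≤-Reasoning

  eventually-periodic-density : ∀ {S : SubsetNat} (S? : Decidable S) M →
    (∀ n → M ≤ n → S n → P n) → (∀ n → M ≤ n → P n → S n) → HasDensity S S? ((+ W) / K)
  eventually-periodic-density {S} S? M S⊆P P⊆S =
    density-from-discrepancy S? K W (K * K + K * M) upper lower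
    where
    upper : ∀ n → K * count S S? n ≤ W * n + (K * K + K * M)
    upper n = begin
      K * count S S? n       ≤⟨ *-monoʳ-≤ K (count-mono-from S? P? M S⊆P n) ⟩
      K * (c n + M)          ≡⟨ *-distribˡ-+ K (c n) M ⟩
      K * c n + K * M        ≤⟨ +-monoˡ-≤ (K * M) (count-discrepancyˡ n) ⟩
      W * n + K * K + K * M  ≡⟨ +-assoc (W * n) (K * K) (K * M) ⟩
      W * n + (K * K + K * M) ∎
      where open ≤-Reasoning
    lower : ∀ n → W * n ≤ K * count S S? n + (K * K + K * M)
    lower n = begin
      W * n                         ≤⟨ count-discrepancyʳ n ⟩
      K * c n + K * K               ≤⟨ +-monoˡ-≤ (K * K) (*-monoʳ-≤ K (count-mono-from P? S? M P⊆S n)) ⟩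
      K * (count S S? n + M) + K * K ≡⟨ cong (_+ K * K) (*-distribˡ-+ K (count S S? n) M) ⟩
      K * count S S? n + K * M + K * K ≡⟨ solve 3 (λ x y z → x :+ y :+ z := x :+ (z :+ y)) refl (K * count S S? n) (K * M) (K * K) ⟩
      K * count S S? n + (K * K + K * M) ∎
      where open ≤-Reasoning

progressions : ℕ → List ℕ → ZCode
progressions K = map (_, K)

segment : ℕ → ZCode
segment M = map (_, 0) (downFrom (suc M))

residueCount : ℕ → List ℕ → ℕ
residueCount K rs = count ⟦ progressions K rs ⟧ ⟦ progressions K rs ⟧? K

InResidues : ℕ → List ℕ → SubsetNat
InResidues N rs u = Any (λ r → InAP (r , N) u) rs

segment⁺ : ∀ {M n} → n ≤ M → ⟦ segment M ⟧ n
segment⁺ {n = n} n≤M = Anyₚ.map⁺ (Anyₚ.applyDownFrom⁺ (λ x → x) (0 , sym (+-identityʳ n)) (s≤s n≤M))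

segment⁻ : ∀ {M n} → ⟦ segment M ⟧ n → n ≤ M
segment⁻ p with Anyₚ.applyDownFrom⁻ (λ x → x) (Anyₚ.map⁻ p)
... | x , x<1+M , (_ , refl) = ≤-pred (subst (_< _) (sym (+-identityʳ x)) x<1+M)

module _ {K : ℕ} where

  progression-+K : ∀ {r n} → InAP (r , K) n → InAP (r , K) (n + K)
  progression-+K {r} (m , refl) = suc m , solve 3 (λ r K m → r :+ K :* m :+ K := r :+ K :* (con 1 :+ m)) refl r K m

  progression-∸K : ∀ {r n} → r < K → InAP (r , K) (n + K) → InAP (r , K) n
  progression-∸K {r} {n} r<K (zero , n+K≡r) =
    ⊥-elim (<⇒≱ r<K (subst (K ≤_) (trans n+K≡r (trans (cong (_+_ r) (*-zeroʳ K)) (+-identityʳ r))) (m≤n+m K n)))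
  progression-∸K {r} {n} r<K (suc m , eq) =
    m , +-cancelʳ-≡ K n (r + K * m) (trans eq (solve 3 (λ r K m → r :+ K :* (con 1 :+ m) := r :+ K :* m :+ K) refl r K m))

  progression-residue-unique : ∀ {r r′ n} .{{_ : NonZero K}} → r < K → r′ < K →
                               InAP (r , K) n → InAP (r′ , K) n → r ≡ r′
  progression-residue-unique {r} {r′} r<K r′<K (m , refl) (m′ , eq) = begin
    r                  ≡⟨ sym (m<n⇒m%n≡m r<K) ⟩
    r % K              ≡⟨ sym ([m+kn]%n≡m%n r m K) ⟩
    (r + m * K) % K    ≡⟨ cong (λ x → (r + x) % K) (*-comm m K) ⟩
    (r + K * m) % K    ≡⟨ cong (_% K) eq ⟩
    (r′ + K * m′) % K  ≡⟨ cong (λ x → (r′ + x) % K) (*-comm K m′) ⟩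
    (r′ + m′ * K) % K  ≡⟨ [m+kn]%n≡m%n r′ m′ K ⟩
    r′ % K             ≡⟨ m<n⇒m%n≡m r′<K ⟩
    r′                 ∎
    where open ≡-Reasoning

  count-progression : ∀ {r} → r < K → count (λ n → InAP (r , K) n) (inAP? (r , K)) K ≡ 1
  count-progression {zero} 0<K = count-≡1 (inAP? (0 , K)) K K 0<K ≤-refl (1 , sym (*-identityʳ K)) unique
    where
    unique : ∀ n → 1 ≤ n → n ≤ K → InAP (0 , K) n → n ≡ K
    unique n 1≤n n≤K (zero , refl) = ⊥-elim (<⇒≱ 1≤n (≤-reflexive (*-zeroʳ K)))
    unique n 1≤n n≤K (suc zero , refl) = *-identityʳ K
    unique n 1≤n n≤K (suc (suc m) , refl) =
      ⊥-elim (<⇒≱ (subst (K <_) (sym (*-suc K (suc m))) (m<m+n K (<-≤-trans 0<K (m≤m*n K (suc m))))) n≤K)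
  count-progression {suc r} r<K = count-≡1 (inAP? (suc r , K)) K (suc r) (s≤s z≤n) (<⇒≤ r<K) (0 , sym r+K*0≡r) unique
    where
    r+K*0≡r : suc r + K * 0 ≡ suc r
    r+K*0≡r = trans (cong (_+_ (suc r)) (*-zeroʳ K)) (+-identityʳ (suc r))
    unique : ∀ n → 1 ≤ n → n ≤ K → InAP (suc r , K) n → n ≡ suc r
    unique n 1≤n n≤K (zero , refl) = r+K*0≡r
    unique n 1≤n n≤K (suc m , refl) = ⊥-elim (<⇒≱ (s≤s (≤-trans (m≤m*n K (suc m)) (m≤n+m _ r))) n≤K)

  progressions-+K : ∀ rs {n} → ⟦ progressions K rs ⟧ n → ⟦ progressions K rs ⟧ (n + K)
  progressions-+K (r ∷ rs) (here p)  = here (progression-+K p)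
  progressions-+K (r ∷ rs) (there p) = there (progressions-+K rs p)

  progressions-∸K : ∀ {rs n} → All (_< K) rs → ⟦ progressions K rs ⟧ (n + K) → ⟦ progressions K rs ⟧ n
  progressions-∸K (r<K ∷ _)    (here p)  = here (progression-∸K r<K p)
  progressions-∸K (_ ∷ rs<K)   (there p) = there (progressions-∸K rs<K p)

  residueCount-[] : residueCount K [] ≡ 0
  residueCount-[] = count-≡0 ⟦ [] ⟧? K (λ _ _ _ ())

  residueCount-≤ : ∀ {rs} → All (_< K) rs → residueCount K rs ≤ length rs
  residueCount-≤ []                  = ≤-reflexive residueCount-[]
  residueCount-≤ {r ∷ rs} (r<K ∷ rs<K) = begin
    residueCount K (r ∷ rs)
      ≤⟨ count-∪-≤ (inAP? (r , K)) ⟦ progressions K rs ⟧? ⟦ progressions K (r ∷ rs) ⟧? (λ _ → toSum) K ⟩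
    count _ (inAP? (r , K)) K + residueCount K rs
      ≤⟨ +-mono-≤ (≤-reflexive (count-progression r<K)) (residueCount-≤ rs<K) ⟩
    suc (length rs)
      ∎
    where open ≤-Reasoning

  residueCount-≡ : ∀ {rs} .{{_ : NonZero K}} → AllPairs _≢_ rs → All (_< K) rs → residueCount K rs ≡ length rs
  residueCount-≡ []                  []           = residueCount-[]
  residueCount-≡ {r ∷ rs} (r∉rs ∷ rs-distinct) (r<K ∷ rs<K) = begin
    residueCount K (r ∷ rs)
      ≡⟨ count-∪-disjoint (inAP? (r , K)) ⟦ progressions K rs ⟧? ⟦ progressions K (r ∷ rs) ⟧? (λ _ → toSum)
                          (λ _ → here) (λ _ → there) (λ _ → r∉progressions r∉rs rs<K) K ⟩
    count _ (inAP? (r , K)) K + residueCount K rs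
      ≡⟨ cong₂ _+_ (count-progression r<K) (residueCount-≡ rs-distinct rs<K) ⟩
    suc (length rs)
      ∎
    where
    open ≡-Reasoning
    r∉progressions : ∀ {rs n} → All (r ≢_) rs → All (_< K) rs → InAP (r , K) n → ¬ ⟦ progressions K rs ⟧ n
    r∉progressions (r≢r′ ∷ _) (r′<K ∷ _) p (here q)  = r≢r′ (progression-residue-unique r<K r′<K p q)
    r∉progressions (_ ∷ r∉rs) (_ ∷ rs<K) p (there q) = r∉progressions r∉rs rs<K p q

module _ {K : ℕ} .{{_ : NonZero K}} {rs : List ℕ} (rs<K : All (_< K) rs) where

  open Periodic ⟦ progressions K rs ⟧? K (progressions-+K rs) (progressions-∸K rs<K) using (eventually-periodic-density)

  progressions-density : ZDensity (progressions K rs) ((+ residueCount K rs) / K)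
  progressions-density = eventually-periodic-density ⟦ progressions K rs ⟧? 0 (λ _ _ p → p) (λ _ _ p → p)

  progressions-segment-density : ∀ M → ZDensity (progressions K rs ++ segment M) ((+ residueCount K rs) / K)
  progressions-segment-density M = eventually-periodic-density ⟦ progressions K rs ++ segment M ⟧? (suc M) beyond (λ _ _ → Anyₚ.++⁺ˡ)
    where
    beyond : ∀ n → suc M ≤ n → ⟦ progressions K rs ++ segment M ⟧ n → ⟦ progressions K rs ⟧ n
    beyond n M<n p with Anyₚ.++⁻ (progressions K rs) p
    ... | inj₁ q = q
    ... | inj₂ q = ⊥-elim (<⇒≱ M<n (segment⁻ q))

affine-residues : ∀ a b {N rs u} → InResidues N rs u → InResidues (a * N) (map (λ r → b + a * r) rs) (b + a * u)
affine-residues a b {N} p = Anyₚ.map⁺ (Any.map shift p)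
  where
  shift : ∀ {r u} → InAP (r , N) u → InAP (b + a * r , a * N) (b + a * u)
  shift {r} (t , refl) = t , solve 5 (λ a b r N t → b :+ a :* (r :+ N :* t) := b :+ a :* r :+ a :* N :* t) refl a b r N t

affine-residues⁻ : ∀ a b {N rs n} → InResidues (a * N) (map (λ r → b + a * r) rs) n →
                   ∃ λ u → n ≡ b + a * u × InResidues N rs u
affine-residues⁻ a b {N} {r ∷ rs} (here (t , refl)) =
  r + N * t , solve 5 (λ a b r N t → b :+ a :* r :+ a :* N :* t := b :+ a :* (r :+ N :* t)) refl a b r N t , here (t , refl)
affine-residues⁻ a b {N} {r ∷ rs} (there p) with affine-residues⁻ a b p
... | u , eq , q = u , eq , there q

affine-< : ∀ {a b N r} → b < a → r < N → b + a * r < a * N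
affine-< {a} {b} {N} {r} b<a r<N = begin-strict
  b + a * r   <⟨ +-monoˡ-< (a * r) b<a ⟩
  a + a * r   ≡⟨ sym (*-suc a r) ⟩
  a * suc r   ≤⟨ *-monoʳ-≤ a r<N ⟩
  a * N       ∎
  where open ≤-Reasoning

offset : ZCode → ℕ
offset []            = 0
offset ((a , _) ∷ c) = a + offset c

period : ZCode → ℕ
period []                = 1
period ((_ , zero) ∷ c)  = period c
period ((_ , suc k) ∷ c) = suc k * period c

period>0 : ∀ c → 0 < period c
period>0 []                = s≤s z≤n
period>0 ((_ , zero) ∷ c)  = period>0 c
period>0 ((_ , suc k) ∷ c) = <-≤-trans (period>0 c) (m≤n*m (period c) (suc k))

⟦⟧-+period : ∀ c {n} → offset c < n → ⟦ c ⟧ n → ∀ s → ⟦ c ⟧ (n + period c * s)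
⟦⟧-+period ((a , zero) ∷ c) a+o<n (here (m , refl)) s = ⊥-elim (<⇒≱ a+o<n (+-monoʳ-≤ a z≤n))
⟦⟧-+period ((a , suc k) ∷ c) _ (here (m , refl)) s = here (m + period c * s , eq)
  where
  eq : a + suc k * m + suc k * period c * s ≡ a + suc k * (m + period c * s)
  eq = solve 5 (λ a k m p s → a :+ k :* m :+ k :* p :* s := a :+ k :* (m :+ p :* s)) refl a (suc k) m (period c) s
⟦⟧-+period ((a , zero) ∷ c) a+o<n (there p) s = there (⟦⟧-+period c (≤-trans (s≤s (m≤n+m (offset c) a)) a+o<n) p s)
⟦⟧-+period ((a , suc k) ∷ c) {n} a+o<n (there p) s =
  there (subst (λ x → ⟦ c ⟧ (n + x)) eq (⟦⟧-+period c (≤-trans (s≤s (m≤n+m (offset c) a)) a+o<n) p (suc k * s)))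
  where
  eq : period c * (suc k * s) ≡ suc k * period c * s
  eq = solve 3 (λ p k s → p :* (k :* s) := k :* p :* s) refl (period c) (suc k) s

⟦⟧-∸period : ∀ c {n} t → offset c ≤ n → ⟦ c ⟧ (n + period c * t) → ⟦ c ⟧ n
⟦⟧-∸period ((a , zero) ∷ c) {n} t a+o≤n (here (m , eq)) =
  here (0 , ≤-antisym (≤-trans (m≤m+n n _) (≤-reflexive eq))
                      (≤-trans (≤-reflexive (+-identityʳ a)) (≤-trans (m≤m+n a (offset c)) a+o≤n)))
⟦⟧-∸period ((a , suc k) ∷ c) {n} t a+o≤n (here (m , eq)) = here (m ∸ period c * t , n≡a+[k+1][m∸pt])
  where
  pt = period c * t
  n+[k+1]pt≡a+[k+1]m : n + suc k * pt ≡ a + suc k * m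
  n+[k+1]pt≡a+[k+1]m = trans (cong (_+_ n) (sym (*-assoc (suc k) (period c) t))) eq
  pt≤m : pt ≤ m
  pt≤m with pt ≤? m
  ... | yes pt≤m = pt≤m
  ... | no  pt≰m = ⊥-elim (<-irrefl (sym n+[k+1]pt≡a+[k+1]m)
          (+-mono-≤-< (≤-trans (m≤m+n a (offset c)) a+o≤n) (*-monoʳ-< (suc k) (≰⇒> pt≰m))))
  n≡a+[k+1][m∸pt] : n ≡ a + suc k * (m ∸ pt)
  n≡a+[k+1][m∸pt] = +-cancelʳ-≡ (suc k * pt) n (a + suc k * (m ∸ pt)) (begin
    n + suc k * pt                     ≡⟨ n+[k+1]pt≡a+[k+1]m ⟩
    a + suc k * m                      ≡⟨ cong (λ x → a + suc k * x) (sym (m∸n+n≡m pt≤m)) ⟩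
    a + suc k * (m ∸ pt + pt)          ≡⟨ solve 4 (λ a k x y → a :+ k :* (x :+ y) := a :+ k :* x :+ k :* y) refl a (suc k) (m ∸ pt) pt ⟩
    a + suc k * (m ∸ pt) + suc k * pt  ∎)
    where open ≡-Reasoning
⟦⟧-∸period ((a , zero) ∷ c) t a+o≤n (there p) = there (⟦⟧-∸period c t (≤-trans (m≤n+m (offset c) a) a+o≤n) p)
⟦⟧-∸period ((a , suc k) ∷ c) {n} t a+o≤n (there p) =
  there (⟦⟧-∸period c (suc k * t) (≤-trans (m≤n+m (offset c) a) a+o≤n) (subst (λ x → ⟦ c ⟧ (n + x)) eq p))
  where
  eq : suc k * period c * t ≡ period c * (suc k * t)
  eq = solve 3 (λ p k s → k :* p :* s := p :* (k :* s)) refl (period c) (suc k) t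

fromℚ : ℚ → ℝ
fromℚ q = record
  { L = ℚ._< q
  ; U = q ℚ.<_
  ; L-inhabited = q ℚ.- 1ℚ , subst (q ℚ.- 1ℚ ℚ.<_) (ℚP.+-identityʳ q) (ℚP.+-monoʳ-< q (ℚP.negative⁻¹ (ℚ.- 1ℚ)))
  ; U-inhabited = q ℚ.+ 1ℚ , subst (ℚ._< q ℚ.+ 1ℚ) (ℚP.+-identityʳ q) (ℚP.+-monoʳ-< q (ℚP.positive⁻¹ 1ℚ))
  ; L-lower = ℚP.<-trans
  ; U-upper = λ p<p′ q<p → ℚP.<-trans q<p p<p′
  ; L-open = λ p<q → let r , p<r , r<q = ℚP.<-dense p<q in r , p<r , r<q
  ; U-open = λ q<p → let r , q<r , r<p = ℚP.<-dense q<p in r , r<p , q<r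
  ; disjoint = λ (p<q , q<p) → ℚP.<-asym p<q q<p
  ; located = split
  }
  where
  split : ∀ {p p′} → p ℚ.< p′ → p ℚ.< q ⊎ q ℚ.< p′
  split {p} {p′} p<p′ with ℚP.<-cmp p q
  ... | tri< p<q _ _ = inj₁ p<q
  ... | tri≈ _ refl _ = inj₂ p<p′
  ... | tri> _ _ q<p = inj₂ (ℚP.<-trans q<p p<p′)

U-upper-≤ : ∀ (x : ℝ) {p q} → x ℝ< p → p ℚ.≤ q → x ℝ< q
U-upper-≤ x {p} {q} x<p p≤q with ℚP.<-cmp p q
... | tri< p<q _ _ = U-upper x p<q x<p
... | tri≈ _ refl _ = x<p
... | tri> _ _ q<p = ⊥-elim (ℚP.<-irrefl refl (ℚP.<-≤-trans q<p p≤q))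

L<U : ∀ (x : ℝ) {p q} → p <ℝ x → x ℝ< q → p ℚ.< q
L<U x {p} {q} p<x x<q with ℚP.<-cmp p q
... | tri< p<q _ _ = p<q
... | tri≈ _ refl _ = ⊥-elim (disjoint x (p<x , x<q))
... | tri> _ _ q<p = ⊥-elim (disjoint x (L-lower x q<p p<x , x<q))

fromℚ-<⇒≉ : ∀ {p q} → p ℚ.< q → ¬ fromℚ p ≈ℝ fromℚ q
fromℚ-<⇒≉ {p} p<q (sameL , _) = ℚP.<-irrefl refl (Equivalence.from (sameL p) p<q)

InnerApproximation : SubsetNat → ℚ → Set
InnerApproximation X r = Σ ZCode λ c → Σ ℚ λ q → ⟦ c ⟧ ⊆ X × ZDensity c q × r ℚ.< q

OuterApproximation : SubsetNat → ℚ → Set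
OuterApproximation X r = Σ ZCode λ c → Σ ℚ λ q → X ⊆ ⟦ c ⟧ × ZDensity c q × q ℚ.< r

hasBuckDensity : ∀ {X α} → (∀ r → r <ℝ α → InnerApproximation X r) → (∀ r → α ℝ< r → OuterApproximation X r) →
                 HasBuckDensity X α
hasBuckDensity {X} {α} inner outer = (coversAbove , outer) , (subsetsBelow , inner)
  where
  coversAbove : ∀ c q → X ⊆ ⟦ c ⟧ → ZDensity c q → α ℝ≤ q
  coversAbove c q X⊆c dc q<α =
    let c′ , q′ , c′⊆X , dc′ , q<q′ = inner q q<α
    in  density-mono ⟦ c′ ⟧? ⟦ c ⟧? (λ n → X⊆c n ∘ c′⊆X n) dc′ dc q<q′
  subsetsBelow : ∀ c q → ⟦ c ⟧ ⊆ X → ZDensity c q → q ≤ℝ α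
  subsetsBelow c q c⊆X dc α<q =
    let c′ , q′ , X⊆c′ , dc′ , q′<q = outer q α<q
    in  density-mono ⟦ c ⟧? ⟦ c′ ⟧? (λ n → X⊆c′ n ∘ c⊆X n) dc dc′ q′<q

isUpperBuck-fromℚ : ∀ {X q} c → X ⊆ ⟦ c ⟧ → ZDensity c q →
  (∀ c′ q′ → X ⊆ ⟦ c′ ⟧ → ZDensity c′ q′ → ¬ q′ ℚ.< q) → IsUpperBuck X (fromℚ q)
isUpperBuck-fromℚ {q = q} c X⊆c dc coversAbove = coversAbove , λ r q<r → c , q , X⊆c , dc , q<r

isLowerBuck-fromℚ : ∀ {X q} c → ⟦ c ⟧ ⊆ X → ZDensity c q →
  (∀ c′ q′ → ⟦ c′ ⟧ ⊆ X → ZDensity c′ q′ → ¬ q ℚ.< q′) → IsLowerBuck X (fromℚ q)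
isLowerBuck-fromℚ {q = q} c c⊆X dc subsetsBelow = subsetsBelow , λ r r<q → c , q , c⊆X , dc , r<q

ℕ-code : ZCode
ℕ-code = progressions 1 (0 ∷ [])

ℕ-code-all : ∀ n → ⟦ ℕ-code ⟧ n
ℕ-code-all n = here (n , sym (*-identityˡ n))

ℕ-code-density : ZDensity ℕ-code 1ℚ
ℕ-code-density = progressions-density {K = 1} (s≤s z≤n ∷ [])

tail-density : ∀ M → HasDensity (M ≤_) (M ≤?_) 1ℚ
tail-density M = Periodic.eventually-periodic-density ⟦ ℕ-code ⟧? 1 (progressions-+K _) (progressions-∸K (s≤s z≤n ∷ []))
                   (M ≤?_) M (λ n _ _ → ℕ-code-all n) (λ _ M≤n _ → M≤n)

MeetsEveryProgression : SubsetNat → Set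
MeetsEveryProgression X = ∀ n K → 0 < K → ∃ λ t → X (n + K * t)

MissedByProgressionsIn2+3ℕ : SubsetNat → Set
MissedByProgressionsIn2+3ℕ X = ∀ y K → 0 < K → ∃ λ t → ¬ X (2 + 3 * (y + K * t))

tail⊆⟦⟧ : ∀ {X} → MeetsEveryProgression X → ∀ c → X ⊆ ⟦ c ⟧ → ∀ n → offset c ≤ n → ⟦ c ⟧ n
tail⊆⟦⟧ meets c X⊆c n o≤n =
  let t , n+pt∈X = meets n (period c) (period>0 c) in ⟦⟧-∸period c t o≤n (X⊆c _ n+pt∈X)

isUpperBuck-1 : ∀ {X} → MeetsEveryProgression X → IsUpperBuck X (fromℚ 1ℚ)
isUpperBuck-1 meets = isUpperBuck-fromℚ ℕ-code (λ n _ → ℕ-code-all n) ℕ-code-density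
  λ c q X⊆c dc → density-mono (offset c ≤?_) ⟦ c ⟧? (tail⊆⟦⟧ meets c X⊆c) (tail-density (offset c)) dc

mod3 : ∀ y → (∃ λ z → y ≡ 3 * z) ⊎ (∃ λ z → y ≡ 1 + 3 * z) ⊎ (∃ λ z → y ≡ 2 + 3 * z)
mod3 zero = inj₁ (0 , refl)
mod3 (suc y) with mod3 y
... | inj₁ (z , refl)         = inj₂ (inj₁ (z , refl))
... | inj₂ (inj₁ (z , refl))  = inj₂ (inj₂ (z , refl))
... | inj₂ (inj₂ (z , refl))  = inj₁ (suc z , sym (*-suc 3 z))

classes₀₁ : ZCode
classes₀₁ = progressions 3 (0 ∷ 1 ∷ [])

private
  0,1<3 : All (_< 3) (0 ∷ 1 ∷ [])
  0,1<3 = s≤s z≤n ∷ s≤s (s≤s z≤n) ∷ []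

⟦⟧⊆classes₀₁ : ∀ {X} → MissedByProgressionsIn2+3ℕ X →
               ∀ c → ⟦ c ⟧ ⊆ X → ⟦ c ⟧ ⊆ ⟦ classes₀₁ ++ segment (offset c) ⟧
⟦⟧⊆classes₀₁ missing c c⊆X n p with n ≤? offset c | mod3 n
... | yes n≤o | _                     = Anyₚ.++⁺ʳ classes₀₁ (segment⁺ n≤o)
... | no _    | inj₁ (z , refl)        = Anyₚ.++⁺ˡ {xs = classes₀₁} (here (z , refl))
... | no _    | inj₂ (inj₁ (z , refl)) = Anyₚ.++⁺ˡ {xs = classes₀₁} (there (here (z , refl)))
... | no o≮n  | inj₂ (inj₂ (z , refl)) with missing z (period c) (period>0 c)
...   | t , ∉X = ⊥-elim (∉X (c⊆X _ (subst ⟦ c ⟧ eq (⟦⟧-+period c (≰⇒> o≮n) p (3 * t)))))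
  where
  eq : 2 + 3 * z + period c * (3 * t) ≡ 2 + 3 * (z + period c * t)
  eq = solve 3 (λ z p t → con 2 :+ con 3 :* z :+ p :* (con 3 :* t) := con 2 :+ con 3 :* (z :+ p :* t)) refl z (period c) t

isLowerBuck-⅔ : ∀ {X} → (∀ z → X (3 * z)) → (∀ z → X (1 + 3 * z)) → MissedByProgressionsIn2+3ℕ X →
                IsLowerBuck X (fromℚ (+ 2 / 3))
isLowerBuck-⅔ {X} X₀ X₁ missing = isLowerBuck-fromℚ classes₀₁ classes₀₁⊆X (progressions-density 0,1<3)
  λ c q c⊆X dc → density-mono ⟦ c ⟧? ⟦ classes₀₁ ++ segment (offset c) ⟧? (⟦⟧⊆classes₀₁ missing c c⊆X) dc
                   (progressions-segment-density 0,1<3 (offset c))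
  where
  classes₀₁⊆X : ⟦ classes₀₁ ⟧ ⊆ X
  classes₀₁⊆X n (here (z , refl))         = X₀ z
  classes₀₁⊆X n (there (here (z , refl))) = X₁ z

bit : ℕ → ℕ
bit zero          = 0
bit (suc zero)    = 1
bit (suc (suc n)) = bit n

bit≤1 : ∀ m → bit m ≤ 1
bit≤1 zero          = z≤n
bit≤1 (suc zero)    = s≤s z≤n
bit≤1 (suc (suc m)) = bit≤1 m

bit+2*half : ∀ m → m ≡ bit m + 2 * ⌊ m /2⌋
bit+2*half zero          = refl
bit+2*half (suc zero)    = refl
bit+2*half (suc (suc m)) = trans (cong (λ x → 2 + x) (bit+2*half m))
  (solve 2 (λ b h → con 2 :+ (b :+ con 2 :* h) := b :+ con 2 :* (con 1 :+ h)) refl (bit m) ⌊ m /2⌋)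

bit-half-unique : ∀ {b} m → b ≤ 1 → bit (b + 2 * m) ≡ b × ⌊ b + 2 * m /2⌋ ≡ m
bit-half-unique {zero}  zero    _ = refl , refl
bit-half-unique {suc zero} zero _ = refl , refl
bit-half-unique {suc (suc _)} zero (s≤s ())
bit-half-unique {b} (suc m) b≤1
  rewrite solve 2 (λ b m → b :+ con 2 :* (con 1 :+ m) := con 2 :+ (b :+ con 2 :* m)) refl b m
  = proj₁ (bit-half-unique m b≤1) , cong suc (proj₂ (bit-half-unique m b≤1))

bit-fixed : ∀ {b} → b ≤ 1 → bit b ≡ b
bit-fixed z≤n       = refl
bit-fixed (s≤s z≤n) = refl

bit-unique : ∀ {b} m → b ≤ 1 → bit (b + 2 * m) ≡ b
bit-unique m b≤1 = proj₁ (bit-half-unique m b≤1)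

half-unique : ∀ {b} m → b ≤ 1 → ⌊ b + 2 * m /2⌋ ≡ m
half-unique m b≤1 = proj₂ (bit-half-unique m b≤1)

private
  regroup : ∀ x z → x + 2 * z ≡ bit x + 2 * (⌊ x /2⌋ + z)
  regroup x z = trans (cong (_+ 2 * z) (bit+2*half x))
    (solve 3 (λ b h z → b :+ con 2 :* h :+ con 2 :* z := b :+ con 2 :* (h :+ z)) refl (bit x) ⌊ x /2⌋ z)

bit-+2* : ∀ x z → bit (x + 2 * z) ≡ bit x
bit-+2* x z = trans (cong bit (regroup x z)) (bit-unique (⌊ x /2⌋ + z) (bit≤1 x))

half-+2* : ∀ x z → ⌊ x + 2 * z /2⌋ ≡ ⌊ x /2⌋ + z
half-+2* x z = trans (cong ⌊_/2⌋ (regroup x z)) (half-unique (⌊ x /2⌋ + z) (bit≤1 x))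

half-< : ∀ J x → x < 2 ^ suc J → ⌊ x /2⌋ < 2 ^ J
half-< J x x< = *-cancelˡ-< 2 ⌊ x /2⌋ (2 ^ J) (≤-<-trans (m≤n+m (2 * ⌊ x /2⌋) (bit x)) (subst (_< 2 * 2 ^ J) (bit+2*half x) x<))

bit+2*-< : ∀ J {b x} → b ≤ 1 → x < 2 ^ J → b + 2 * x < 2 ^ suc J
bit+2*-< J {b} {x} b≤1 x< = begin-strict
  b + 2 * x    ≤⟨ +-monoˡ-≤ (2 * x) b≤1 ⟩
  1 + 2 * x    <⟨ ≤-reflexive (solve 1 (λ x → con 2 :+ con 2 :* x := con 2 :* (con 1 :+ x)) refl x) ⟩
  2 * suc x    ≤⟨ *-monoʳ-≤ 2 x< ⟩
  2 ^ suc J    ∎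
  where open ≤-Reasoning

rev : ℕ → ℕ → ℕ
rev zero    m = 0
rev (suc j) m = bit m * 2 ^ j + rev j ⌊ m /2⌋

high : ℕ → ℕ → ℕ
high zero    m = m
high (suc j) m = high j ⌊ m /2⌋

rev-< : ∀ j m → rev j m < 2 ^ j
rev-< zero    m = s≤s z≤n
rev-< (suc j) m = begin-strict
  bit m * 2 ^ j + rev j ⌊ m /2⌋  <⟨ +-monoʳ-< (bit m * 2 ^ j) (rev-< j ⌊ m /2⌋) ⟩
  bit m * 2 ^ j + 2 ^ j          ≤⟨ +-monoˡ-≤ (2 ^ j) (*-monoˡ-≤ (2 ^ j) (bit≤1 m)) ⟩
  1 * 2 ^ j + 2 ^ j              ≡⟨ solve 1 (λ x → con 1 :* x :+ x := con 2 :* x) refl (2 ^ j) ⟩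
  2 ^ suc j                      ∎
  where open ≤-Reasoning

rev-+ : ∀ j d m → rev (j + d) m ≡ rev j m * 2 ^ d + rev d (high j m)
rev-+ zero    d m = refl
rev-+ (suc j) d m = begin
  bit m * 2 ^ (j + d) + rev (j + d) ⌊ m /2⌋
    ≡⟨ cong₂ _+_ (cong (bit m *_) (^-distribˡ-+-* 2 j d)) (rev-+ j d ⌊ m /2⌋) ⟩
  bit m * (2 ^ j * 2 ^ d) + (rev j ⌊ m /2⌋ * 2 ^ d + rev d (high j ⌊ m /2⌋))
    ≡⟨ solve 5 (λ b p q r s → b :* (p :* q) :+ (r :* q :+ s) := (b :* p :+ r) :* q :+ s) refl
               (bit m) (2 ^ j) (2 ^ d) (rev j ⌊ m /2⌋) (rev d (high j ⌊ m /2⌋)) ⟩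
  (bit m * 2 ^ j + rev j ⌊ m /2⌋) * 2 ^ d + rev d (high j ⌊ m /2⌋) ∎
  where open ≡-Reasoning

rev-mod : ∀ J x y → rev J (x + 2 ^ J * y) ≡ rev J x
rev-mod zero    x y = refl
rev-mod (suc J) x y rewrite *-assoc 2 (2 ^ J) y =
  cong₂ _+_ (cong (_* 2 ^ J) (bit-+2* x (2 ^ J * y)))
            (trans (cong (rev J) (half-+2* x (2 ^ J * y))) (rev-mod J ⌊ x /2⌋ y))

high-+ : ∀ J x y → x < 2 ^ J → high J (x + 2 ^ J * y) ≡ y
high-+ zero    zero    y _ = +-identityʳ y
high-+ zero    (suc x) y (s≤s ())
high-+ (suc J) x       y x< rewrite *-assoc 2 (2 ^ J) y =
  trans (cong (high J) (half-+2* x (2 ^ J * y))) (high-+ J ⌊ x /2⌋ y (half-< J x x<))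

low-high : ∀ J m → Σ ℕ λ x → x < 2 ^ J × m ≡ x + 2 ^ J * high J m
low-high zero    m = 0 , s≤s z≤n , sym (+-identityʳ m)
low-high (suc J) m with low-high J ⌊ m /2⌋
... | x , x< , eq = bit m + 2 * x , bit+2*-< J (bit≤1 m) x< , (begin
  m                                              ≡⟨ bit+2*half m ⟩
  bit m + 2 * ⌊ m /2⌋                            ≡⟨ cong (λ h → bit m + 2 * h) eq ⟩
  bit m + 2 * (x + 2 ^ J * high J ⌊ m /2⌋)       ≡⟨ solve 4 (λ b x p h → b :+ con 2 :* (x :+ p :* h) := b :+ con 2 :* x :+ con 2 :* p :* h)
                                                          refl (bit m) x (2 ^ J) (high J ⌊ m /2⌋) ⟩
  bit m + 2 * x + 2 ^ suc J * high J ⌊ m /2⌋     ∎)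
  where open ≡-Reasoning

rev-involutive : ∀ J x → x < 2 ^ J → rev J (rev J x) ≡ x
rev-involutive zero    zero _  = refl
rev-involutive zero    (suc x) (s≤s ())
rev-involutive (suc J) x  x< = begin
  rev (suc J) m                           ≡⟨ cong (λ k → rev k m) (+-comm 1 J) ⟩
  rev (J + 1) m                           ≡⟨ rev-+ J 1 m ⟩
  rev J m * 2 ^ 1 + rev 1 (high J m)      ≡⟨ cong₂ (λ u v → u * 2 ^ 1 + rev 1 v) rev-m high-m ⟩
  ⌊ x /2⌋ * 2 ^ 1 + rev 1 (bit x)         ≡⟨ cong (λ b → ⌊ x /2⌋ * 2 ^ 1 + (b * 1 + 0)) (bit-fixed (bit≤1 x)) ⟩
  ⌊ x /2⌋ * 2 ^ 1 + (bit x * 1 + 0)       ≡⟨ solve 2 (λ h b → h :* con 2 :+ (b :* con 1 :+ con 0) := b :+ con 2 :* h)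
                                                    refl ⌊ x /2⌋ (bit x) ⟩
  bit x + 2 * ⌊ x /2⌋                     ≡⟨ sym (bit+2*half x) ⟩
  x                                       ∎
  where
  open ≡-Reasoning
  m = rev (suc J) x
  m≡ : m ≡ rev J ⌊ x /2⌋ + 2 ^ J * bit x
  m≡ = trans (+-comm (bit x * 2 ^ J) _) (cong (_+_ (rev J ⌊ x /2⌋)) (*-comm (bit x) (2 ^ J)))
  rev-m : rev J m ≡ ⌊ x /2⌋
  rev-m = trans (cong (rev J) m≡) (trans (rev-mod J _ (bit x)) (rev-involutive J ⌊ x /2⌋ (half-< J x x<)))
  high-m : high J m ≡ bit x
  high-m = trans (cong (high J) m≡) (high-+ J _ (bit x) (rev-< J ⌊ x /2⌋))

rev-rev-high : ∀ J m → m ≡ rev J (rev J m) + 2 ^ J * high J m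
rev-rev-high J m with low-high J m
... | x , x< , eq = trans eq (cong (_+ 2 ^ J * high J m)
                      (sym (trans (cong (λ y → rev J (rev J y)) eq) (trans (cong (rev J) (rev-mod J x (high J m))) (rev-involutive J x x<)))))

rev-prefix : ∀ j J m → rev j m * 2 ^ J < suc (rev J m) * 2 ^ j
rev-prefix j J m with ≤-total j J
... | inj₁ j≤J with m≤n⇒∃[o]m+o≡n j≤J
...   | d , refl = begin-strict
  rev j m * 2 ^ (j + d)                      ≡⟨ cong (rev j m *_) (trans (cong (2 ^_) (+-comm j d)) (^-distribˡ-+-* 2 d j)) ⟩
  rev j m * (2 ^ d * 2 ^ j)                  ≡⟨ sym (*-assoc (rev j m) (2 ^ d) (2 ^ j)) ⟩
  rev j m * 2 ^ d * 2 ^ j                    ≤⟨ *-monoˡ-≤ (2 ^ j) (m≤m+n (rev j m * 2 ^ d) (rev d (high j m))) ⟩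
  (rev j m * 2 ^ d + rev d (high j m)) * 2 ^ j ≡⟨ cong (_* 2 ^ j) (sym (rev-+ j d m)) ⟩
  rev (j + d) m * 2 ^ j                      <⟨ *-monoˡ-< (2 ^ j) {{m^n≢0 2 j}} (n<1+n (rev (j + d) m)) ⟩
  suc (rev (j + d) m) * 2 ^ j                ∎
  where open ≤-Reasoning
rev-prefix j J m | inj₂ J≤j with m≤n⇒∃[o]m+o≡n J≤j
...   | d , refl = begin-strict
  rev (J + d) m * 2 ^ J                             ≡⟨ cong (_* 2 ^ J) (rev-+ J d m) ⟩
  (rev J m * 2 ^ d + rev d (high J m)) * 2 ^ J      <⟨ *-monoˡ-< (2 ^ J) {{m^n≢0 2 J}} (+-monoʳ-< (rev J m * 2 ^ d) (rev-< d (high J m))) ⟩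
  (rev J m * 2 ^ d + 2 ^ d) * 2 ^ J                 ≡⟨ solve 3 (λ r p q → (r :* p :+ p) :* q := (con 1 :+ r) :* (q :* p))
                                                              refl (rev J m) (2 ^ d) (2 ^ J) ⟩
  suc (rev J m) * (2 ^ J * 2 ^ d)                   ≡⟨ cong (suc (rev J m) *_) (sym (^-distribˡ-+-* 2 J d)) ⟩
  suc (rev J m) * 2 ^ (J + d)                       ∎
  where open ≤-Reasoning

spread : ℕ → ℕ → ℕ
spread zero    z = 0
spread (suc i) z = bit z + 4 * spread i ⌊ z /2⌋

spread-< : ∀ i z → 3 * spread i z < 4 ^ i
spread-< zero    z = s≤s z≤n
spread-< (suc i) z = begin-strict
  3 * (bit z + 4 * s)          ≡⟨ solve 2 (λ b s → con 3 :* (b :+ con 4 :* s) := con 3 :* b :+ con 4 :* (con 3 :* s)) refl (bit z) s ⟩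
  3 * bit z + 4 * (3 * s)      ≤⟨ +-monoˡ-≤ (4 * (3 * s)) (*-monoʳ-≤ 3 (bit≤1 z)) ⟩
  3 + 4 * (3 * s)              <⟨ ≤-reflexive (solve 1 (λ s → con 4 :+ con 4 :* s := con 4 :* (con 1 :+ s)) refl (3 * s)) ⟩
  4 * suc (3 * s)              ≤⟨ *-monoʳ-≤ 4 (spread-< i ⌊ z /2⌋) ⟩
  4 ^ suc i                    ∎
  where
  open ≤-Reasoning
  s = spread i ⌊ z /2⌋

spread-suc : ∀ i {b} z → b ≤ 1 → spread (suc i) (b + 2 * z) ≡ b + 4 * spread i z
spread-suc i z b≤1 = cong₂ (λ b h → b + 4 * spread i h) (bit-unique z b≤1) (half-unique z b≤1)

base-4-digit : ∀ n → n ≡ bit n + 2 * bit ⌊ n /2⌋ + 4 * ⌊ ⌊ n /2⌋ /2⌋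
base-4-digit n = trans (bit+2*half n) (trans (cong (λ h → bit n + 2 * h) (bit+2*half ⌊ n /2⌋))
  (solve 3 (λ a b c → a :+ con 2 :* (b :+ con 2 :* c) := a :+ con 2 :* b :+ con 4 :* c) refl (bit n) (bit ⌊ n /2⌋) ⌊ ⌊ n /2⌋ /2⌋))

spread-0 : ∀ i → spread i 0 ≡ 0
spread-0 zero    = refl
spread-0 (suc i) = cong (4 *_) (spread-0 i)

spread-mod : ∀ i i′ z → Σ ℕ λ z′ → Σ ℕ λ w → z′ < 2 ^ i′ × spread i z ≡ spread i′ z′ + 4 ^ i′ * w
spread-mod i       zero     z = 0 , spread i z , s≤s z≤n , sym (+-identityʳ (spread i z))
spread-mod zero    (suc i′) z = 0 , 0 , m^n>0 2 (suc i′) , sym (cong₂ _+_ (spread-0 (suc i′)) (*-zeroʳ (4 ^ suc i′)))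
spread-mod (suc i) (suc i′) z with spread-mod i i′ ⌊ z /2⌋
... | z′ , w , z′< , eq = bit z + 2 * z′ , w , bit+2*-< i′ (bit≤1 z) z′< , (begin
  bit z + 4 * spread i ⌊ z /2⌋                      ≡⟨ cong (λ u → bit z + 4 * u) eq ⟩
  bit z + 4 * (spread i′ z′ + 4 ^ i′ * w)           ≡⟨ solve 4 (λ b s p w → b :+ con 4 :* (s :+ p :* w) := b :+ con 4 :* s :+ con 4 :* p :* w)
                                                             refl (bit z) (spread i′ z′) (4 ^ i′) w ⟩
  bit z + 4 * spread i′ z′ + 4 ^ suc i′ * w         ≡⟨ cong (_+ 4 ^ suc i′ * w) (sym (spread-suc i′ z′ (bit≤1 z))) ⟩
  spread (suc i′) (bit z + 2 * z′) + 4 ^ suc i′ * w ∎)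
  where open ≡-Reasoning

spread-small : ∀ i z q → spread i z < 4 ^ q → 3 * spread i z < 4 ^ q
spread-small i z q s< with spread-mod i q z
... | z′ , zero , _ , eq =
  subst (λ u → 3 * u < 4 ^ q) (sym (trans eq (trans (cong (_+_ (spread q z′)) (*-zeroʳ (4 ^ q))) (+-identityʳ _)))) (spread-< q z′)
... | z′ , suc w , _ , eq = ⊥-elim (<⇒≱ s< (subst (4 ^ q ≤_) (sym eq) (≤-trans (m≤m*n (4 ^ q) (suc w)) (m≤n+m _ _))))

n<2^n : ∀ n → n < 2 ^ n
n<2^n zero    = s≤s z≤n
n<2^n (suc n) = begin-strict
  suc n          <⟨ s≤s (n<2^n n) ⟩
  1 + 2 ^ n      ≤⟨ +-monoˡ-≤ (2 ^ n) (m^n>0 2 n) ⟩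
  2 ^ n + 2 ^ n  ≡⟨ solve 1 (λ p → p :+ p := con 2 :* p) refl (2 ^ n) ⟩
  2 ^ suc n      ∎
  where open ≤-Reasoning

n<4^n : ∀ n → n < 4 ^ n
n<4^n n = <-≤-trans (n<2^n n) (^-monoˡ-≤ n (s≤s (s≤s z≤n)))

spread+2*spread : ∀ L n → n < 4 ^ L → Σ ℕ λ a → Σ ℕ λ b → n ≡ spread L a + 2 * spread L b
spread+2*spread zero    zero    _ = 0 , 0 , refl
spread+2*spread zero    (suc n) (s≤s ())
spread+2*spread (suc L) n n< with spread+2*spread L ⌊ ⌊ n /2⌋ /2⌋ q<
  where
  q< : ⌊ ⌊ n /2⌋ /2⌋ < 4 ^ L
  q< = *-cancelˡ-< 4 _ (4 ^ L) (≤-<-trans (m≤n+m (4 * ⌊ ⌊ n /2⌋ /2⌋) (bit n + 2 * bit ⌊ n /2⌋))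
                                          (subst (_< 4 ^ suc L) (base-4-digit n) n<))
... | a , b , eq = bit n + 2 * a , bit ⌊ n /2⌋ + 2 * b , (begin
  n                                                        ≡⟨ base-4-digit n ⟩
  c₀ + 2 * c₁ + 4 * ⌊ ⌊ n /2⌋ /2⌋                          ≡⟨ cong (λ q → c₀ + 2 * c₁ + 4 * q) eq ⟩
  c₀ + 2 * c₁ + 4 * (spread L a + 2 * spread L b)          ≡⟨ solve 4 (λ c₀ c₁ x y → c₀ :+ con 2 :* c₁ :+ con 4 :* (x :+ con 2 :* y)
                                                                        := c₀ :+ con 4 :* x :+ con 2 :* (c₁ :+ con 4 :* y)) refl c₀ c₁ (spread L a) (spread L b) ⟩
  (c₀ + 4 * spread L a) + 2 * (c₁ + 4 * spread L b)        ≡⟨ sym (cong₂ (λ x y → x + 2 * y) (spread-suc L a (bit≤1 n)) (spread-suc L b (bit≤1 ⌊ n /2⌋))) ⟩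
  spread (suc L) (c₀ + 2 * a) + 2 * spread (suc L) (c₁ + 2 * b) ∎)
  where
  open ≡-Reasoning
  c₀ = bit n
  c₁ = bit ⌊ n /2⌋

multiple-in-window : ∀ K d → 0 < K → ∃ λ t → d ≤ K * t × K * t < d + K
multiple-in-window K zero    0<K = 0 , z≤n , subst (_< K) (sym (*-zeroʳ K)) 0<K
multiple-in-window K (suc d) 0<K with multiple-in-window K d 0<K
... | t , d≤Kt , Kt<d+K with suc d ≤? K * t
...   | yes d<Kt = t , d<Kt , m<n⇒m<1+n Kt<d+K
...   | no  d≮Kt = suc t , subst (suc d ≤_) (sym K[1+t]≡K+d) (+-monoˡ-≤ d 0<K)
                        , subst (_< suc d + K) (sym K[1+t]≡K+d) (subst (_< suc (d + K)) (+-comm d K) (n<1+n (d + K)))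
  where
  K[1+t]≡K+d : K * suc t ≡ K + d
  K[1+t]≡K+d = trans (*-suc K t) (cong (_+_ K) (≤-antisym (≮⇒≥ d≮Kt) d≤Kt))

progression-enters-window : ∀ n K a → 0 < K → n ≤ a → ∃ λ t → a ≤ n + K * t × n + K * t < a + K
progression-enters-window n K a 0<K n≤a with multiple-in-window K (a ∸ n) 0<K
... | t , a-n≤Kt , Kt<a-n+K = t , subst (_≤ n + K * t) (m+[n∸m]≡n n≤a) (+-monoʳ-≤ n a-n≤Kt)
                                , subst (n + K * t <_) (trans (sym (+-assoc n (a ∸ n) K)) (cong (_+ K) (m+[n∸m]≡n n≤a))) (+-monoʳ-< n Kt<a-n+K)

MoserDeBruijn : SubsetNat
MoserDeBruijn u = Σ ℕ λ i → Σ ℕ λ z → u ≡ spread i z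

MoserDeBruijn-sum : ∀ n → Σ ℕ λ e → Σ ℕ λ e′ → MoserDeBruijn e × MoserDeBruijn e′ × n ≡ e + 2 * e′
MoserDeBruijn-sum n with spread+2*spread n n (n<4^n n)
... | a , b , eq = spread n a , spread n b , (n , a , refl) , (n , b , refl) , eq

MoserDeBruijn-small : ∀ {e} q → MoserDeBruijn e → e < 4 ^ q → 3 * e < 4 ^ q
MoserDeBruijn-small q (i , z , refl) = spread-small i z q

Q : SubsetNat
Q u = Σ ℕ λ k → Σ ℕ λ e → MoserDeBruijn e × 2 * e < 4 ^ k × u ≡ 4 ^ (3 * k) + 2 * e

module SumSet (V : SubsetNat) where

  A₀ A₁ A : SubsetNat
  A₀ u = V u ⊎ MoserDeBruijn u ⊎ Σ ℕ λ e → u ≡ 2 * e × MoserDeBruijn e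
  A₁ u = MoserDeBruijn u ⊎ Q u
  A n = (Σ ℕ λ u → n ≡ 3 * u × A₀ u) ⊎ (Σ ℕ λ u → n ≡ 1 + 3 * u × A₁ u)

  3ℕ⊆A⊕A : ∀ z → (A ⊕ A) (3 * z)
  3ℕ⊆A⊕A z with MoserDeBruijn-sum z
  ... | e , e′ , E-e , E-e′ , refl =
    3 * e , 3 * (2 * e′) , inj₁ (e , refl , inj₂ (inj₁ E-e)) , inj₁ (2 * e′ , refl , inj₂ (inj₂ (e′ , refl , E-e′))) ,
    sym (*-distribˡ-+ 3 e (2 * e′))

  1+3ℕ⊆A⊕A : ∀ z → (A ⊕ A) (1 + 3 * z)
  1+3ℕ⊆A⊕A z with MoserDeBruijn-sum z
  ... | e , e′ , E-e , E-e′ , refl =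
    3 * (2 * e′) , 1 + 3 * e , inj₁ (2 * e′ , refl , inj₂ (inj₂ (e′ , refl , E-e′))) , inj₂ (e , refl , inj₁ E-e) ,
    solve 2 (λ e e′ → con 3 :* (con 2 :* e′) :+ (con 1 :+ con 3 :* e) := con 1 :+ con 3 :* (e :+ con 2 :* e′)) refl e e′

  shifted-block⊆A⊕A : ∀ k x → x < 4 ^ k → (A ⊕ A) (2 + 3 * (4 ^ (3 * k) + x))
  shifted-block⊆A⊕A k x x<4^k with MoserDeBruijn-sum x
  ... | e , e′ , E-e , E-e′ , refl =
    1 + 3 * e , 1 + 3 * (4 ^ (3 * k) + 2 * e′) , inj₂ (e , refl , inj₁ E-e) ,
    inj₂ (_ , refl , inj₂ (k , e′ , E-e′ , ≤-<-trans (m≤n+m (2 * e′) e) x<4^k , refl)) ,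
    solve 3 (λ e e′ P → con 1 :+ con 3 :* e :+ (con 1 :+ con 3 :* (P :+ con 2 :* e′)) := con 2 :+ con 3 :* (P :+ (e :+ con 2 :* e′)))
          refl e e′ (4 ^ (3 * k))

  window⊆A⊕A : ∀ k y → 3 * 4 ^ (3 * k) ≤ y → y < 3 * 4 ^ (3 * k) + 4 ^ k → (A ⊕ A) y
  window⊆A⊕A k y lo hi with mod3 y
  ... | inj₁ (z , refl)         = 3ℕ⊆A⊕A z
  ... | inj₂ (inj₁ (z , refl))  = 1+3ℕ⊆A⊕A z
  ... | inj₂ (inj₂ (z , refl))  = subst (A ⊕ A) (cong (λ u → 2 + 3 * u) (m+[n∸m]≡n M≤z))
    (shifted-block⊆A⊕A k (z ∸ M) (subst (z ∸ M <_) (m+n∸m≡n M (4 ^ k)) (∸-monoˡ-< z<M+4^k M≤z)))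
    where
    M = 4 ^ (3 * k)
    M≤z : M ≤ z
    M≤z = ≮⇒≥ λ z<M → <⇒≱ (<-≤-trans (n<1+n (2 + 3 * z)) (≤-trans (≤-reflexive (sym (*-suc 3 z))) (*-monoʳ-≤ 3 z<M))) lo
    z<M+4^k : z < M + 4 ^ k
    z<M+4^k = *-cancelˡ-< 3 z (M + 4 ^ k) (begin-strict
      3 * z              ≤⟨ m≤n+m (3 * z) 2 ⟩
      2 + 3 * z          <⟨ hi ⟩
      3 * M + 4 ^ k      ≤⟨ +-monoʳ-≤ (3 * M) (m≤n*m (4 ^ k) 3) ⟩
      3 * M + 3 * 4 ^ k  ≡⟨ sym (*-distribˡ-+ 3 M (4 ^ k)) ⟩
      3 * (M + 4 ^ k)    ∎)
      where open ≤-Reasoning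

  A⊕A-meets-progressions : MeetsEveryProgression (A ⊕ A)
  A⊕A-meets-progressions n K 0<K =
    let t , lo , hi = progression-enters-window n K (3 * M) 0<K n≤3M
    in  t , window⊆A⊕A k (n + K * t) lo (<-≤-trans hi (+-monoʳ-≤ (3 * M) K≤4^k))
    where
    k = n + K
    M = 4 ^ (3 * k)
    K≤4^k : K ≤ 4 ^ k
    K≤4^k = ≤-trans (m≤n+m K n) (<⇒≤ (n<4^n k))
    n≤3M : n ≤ 3 * M
    n≤3M = ≤-trans (m≤m+n n K) (≤-trans (<⇒≤ (n<4^n k)) (≤-trans (^-monoʳ-≤ 4 (m≤n*m k 3)) (m≤n*m M 3)))

  A₁-sparse : ∀ k {u} → A₁ u → u < 4 ^ (3 + 3 * k) → 3 * u < 4 ^ (3 + 3 * k)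
  A₁-sparse k (inj₁ E-u) u< = MoserDeBruijn-small (3 + 3 * k) E-u u<
  A₁-sparse k {u} (inj₂ (k′ , e , _ , 2e<4^k′ , refl)) u< with k′ ≤? k
  ... | yes k′≤k = begin-strict
    3 * (4 ^ (3 * k′) + 2 * e)   <⟨ *-monoʳ-< 3 (+-monoʳ-< (4 ^ (3 * k′)) 2e<4^k′) ⟩
    3 * (4 ^ (3 * k′) + 4 ^ k′)  ≤⟨ *-monoʳ-≤ 3 (+-mono-≤ P′≤P (≤-trans (^-monoʳ-≤ 4 (m≤n*m k′ 3)) P′≤P)) ⟩
    3 * (P + P)                  ≤⟨ ≤-reflexive (solve 1 (λ P → con 3 :* (P :+ P) := con 6 :* P) refl P) ⟩
    6 * P                        ≤⟨ *-monoˡ-≤ P (m≤m+n 6 58) ⟩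
    64 * P                       ≡⟨ solve 1 (λ P → con 64 :* P := con 4 :* (con 4 :* (con 4 :* P))) refl P ⟩
    4 ^ (3 + 3 * k)              ∎
    where
    open ≤-Reasoning
    P = 4 ^ (3 * k)
    P′≤P : 4 ^ (3 * k′) ≤ P
    P′≤P = ^-monoʳ-≤ 4 (*-monoʳ-≤ 3 k′≤k)
  ... | no k′≰k = ⊥-elim (<⇒≱ u< (≤-trans (^-monoʳ-≤ 4 3+3k≤3k′) (m≤m+n (4 ^ (3 * k′)) (2 * e))))
    where
    3+3k≤3k′ : 3 + 3 * k ≤ 3 * k′
    3+3k≤3k′ = subst (_≤ 3 * k′) (*-suc 3 k) (*-monoʳ-≤ 3 (≰⇒> k′≰k))

  private
    A-mod-3 : ∀ {a} → A a → (∃ λ m → a ≡ 3 * m) ⊎ (∃ λ u → a ≡ 1 + 3 * u × A₁ u)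
    A-mod-3 (inj₁ (m , eq , _))    = inj₁ (m , eq)
    A-mod-3 (inj₂ (u , eq , A₁-u)) = inj₂ (u , eq , A₁-u)

    3*≢2+3* : ∀ m n → 3 * m ≢ 2 + 3 * n
    3*≢2+3* m n eq with progression-residue-unique {3} (s≤s z≤n) (s≤s (s≤s (s≤s z≤n))) (m , refl) (n , eq)
    ... | ()

    1+3*≢2+3* : ∀ m n → 1 + 3 * m ≢ 2 + 3 * n
    1+3*≢2+3* m n eq with progression-residue-unique {3} (s≤s (s≤s z≤n)) (s≤s (s≤s (s≤s z≤n))) (m , refl) (n , eq)
    ... | ()

  A⊕A-class-2 : ∀ {y} → (A ⊕ A) (2 + 3 * y) → Σ ℕ λ u → Σ ℕ λ v → A₁ u × A₁ v × u + v ≡ y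
  A⊕A-class-2 {y} (a , b , A-a , A-b , a+b≡) with A-mod-3 A-a | A-mod-3 A-b
  ... | inj₁ (m , refl) | inj₁ (m′ , refl) = ⊥-elim (3*≢2+3* (m + m′) y (trans (*-distribˡ-+ 3 m m′) a+b≡))
  ... | inj₁ (m , refl) | inj₂ (u , refl , _) = ⊥-elim (1+3*≢2+3* (m + u) y
    (trans (solve 2 (λ m u → con 1 :+ con 3 :* (m :+ u) := con 3 :* m :+ (con 1 :+ con 3 :* u)) refl m u) a+b≡))
  ... | inj₂ (u , refl , _) | inj₁ (m , refl) = ⊥-elim (1+3*≢2+3* (u + m) y
    (trans (solve 2 (λ u m → con 1 :+ con 3 :* (u :+ m) := con 1 :+ con 3 :* u :+ con 3 :* m) refl u m) a+b≡))
  ... | inj₂ (u , refl , A₁-u) | inj₂ (v , refl , A₁-v) =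
    u , v , A₁-u , A₁-v , *-cancelˡ-≡ (u + v) y 3 (+-cancelˡ-≡ 2 (3 * (u + v)) (3 * y)
      (trans (solve 2 (λ u v → con 2 :+ con 3 :* (u :+ v) := con 1 :+ con 3 :* u :+ (con 1 :+ con 3 :* v)) refl u v) a+b≡))

  gap∉A⊕A : ∀ k y → 3 * 4 ^ (2 + 3 * k) ≤ y → y < 4 ^ (3 + 3 * k) → ¬ (A ⊕ A) (2 + 3 * y)
  gap∉A⊕A k y lo hi y∈A⊕A with A⊕A-class-2 {y} y∈A⊕A
  ... | u , v , A₁-u , A₁-v , refl = <⇒≱ 3[u+v]<9T (*-monoʳ-≤ 3 lo)
    where
    T = 4 ^ (2 + 3 * k)
    3[u+v]<9T : 3 * (u + v) < 3 * (3 * T)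
    3[u+v]<9T = begin-strict
      3 * (u + v)            ≡⟨ *-distribˡ-+ 3 u v ⟩
      3 * u + 3 * v          <⟨ +-mono-< (A₁-sparse k A₁-u (≤-<-trans (m≤m+n u v) hi)) (A₁-sparse k A₁-v (≤-<-trans (m≤n+m v u) hi)) ⟩
      4 * T + 4 * T          ≤⟨ ≤-reflexive (solve 1 (λ T → con 4 :* T :+ con 4 :* T := con 8 :* T) refl T) ⟩
      8 * T                  <⟨ *-monoˡ-< T {{m^n≢0 4 (2 + 3 * k)}} (n<1+n 8) ⟩
      9 * T                  ≡⟨ solve 1 (λ T → con 9 :* T := con 3 :* (con 3 :* T)) refl T ⟩
      3 * (3 * T)            ∎
      where open ≤-Reasoning

  A⊕A-misses-progressions : MissedByProgressionsIn2+3ℕ (A ⊕ A)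
  A⊕A-misses-progressions y K 0<K =
    let t , lo , hi = progression-enters-window y K (3 * T) 0<K (≤-trans (m≤m+n y K) (≤-trans k≤T (m≤n*m T 3)))
    in  t , gap∉A⊕A k (y + K * t) lo (<-≤-trans hi (≤-trans (+-monoʳ-≤ (3 * T) (≤-trans (m≤n+m K y) k≤T))
                                                         (≤-reflexive (solve 1 (λ T → con 3 :* T :+ T := con 4 :* T) refl T))))
    where
    k = y + K
    T = 4 ^ (2 + 3 * k)
    k≤T : k ≤ T
    k≤T = ≤-trans (<⇒≤ (n<4^n k)) (^-monoʳ-≤ 4 (≤-trans (m≤n*m k 3) (m≤n+m (3 * k) 2)))

  A⊕A-lowerBuck : IsLowerBuck (A ⊕ A) (fromℚ (+ 2 / 3))
  A⊕A-lowerBuck = isLowerBuck-⅔ 3ℕ⊆A⊕A 1+3ℕ⊆A⊕A A⊕A-misses-progressions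

  A⊕A-upperBuck : IsUpperBuck (A ⊕ A) (fromℚ 1ℚ)
  A⊕A-upperBuck = isUpperBuck-1 A⊕A-meets-progressions

grid-between-ℕ : ∀ a D b E .{{_ : NonZero D}} .{{_ : NonZero E}} → a * E < b * D →
  Σ ℕ λ i → Σ ℕ λ I → a * (3 * 2 ^ (2 * i)) < I * D × (I + 4 * 2 ^ i) * E < b * (3 * 2 ^ (2 * i))
grid-between-ℕ a D b E aE<bD = i , I , aK<ID , [I+4X]E<bK
  where
  -- 2^i > 5 D E makes the rounding error D E (1 + 4·2^i) smaller than K = 3·2^(2i) (error<K).
  i = 5 * (D * E)
  X = 2 ^ i
  K = 3 * 2 ^ (2 * i)
  q = (a * K) div D
  I = suc q
  aK≡ : a * K ≡ (a * K) % D + q * D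
  aK≡ = m≡m%n+[m/n]*n (a * K) D
  aK<ID : a * K < I * D
  aK<ID = begin-strict
    a * K               ≡⟨ aK≡ ⟩
    (a * K) % D + q * D <⟨ +-monoˡ-< (q * D) (m%n<n (a * K) D) ⟩
    I * D               ∎
    where open ≤-Reasoning
  ID≤aK+D : I * D ≤ a * K + D
  ID≤aK+D = begin
    D + q * D               ≡⟨ +-comm D (q * D) ⟩
    q * D + D               ≤⟨ +-monoˡ-≤ D (m≤n+m (q * D) ((a * K) % D)) ⟩
    (a * K) % D + q * D + D ≡⟨ cong (_+ D) (sym aK≡) ⟩
    a * K + D               ∎
    where open ≤-Reasoning
  error<K : D * E * (1 + 4 * X) < K
  error<K = begin-strict
    D * E * (1 + 4 * X)  ≤⟨ *-monoʳ-≤ (D * E) (+-monoˡ-≤ (4 * X) (m^n>0 2 i)) ⟩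
    D * E * (X + 4 * X)  ≡⟨ solve 2 (λ d x → d :* (x :+ con 4 :* x) := con 5 :* d :* x) refl (D * E) X ⟩
    5 * (D * E) * X      <⟨ *-monoˡ-< X {{m^n≢0 2 i}} (n<2^n i) ⟩
    X * X                ≤⟨ m≤n*m (X * X) 3 ⟩
    3 * (X * X)          ≡⟨ cong (3 *_) (sym (^-distribˡ-+-* 2 i i)) ⟩
    3 * 2 ^ (i + i)      ≡⟨ cong (λ j → 3 * 2 ^ j) (solve 1 (λ i → i :+ i := con 2 :* i) refl i) ⟩
    K                    ∎
    where open ≤-Reasoning
  [I+4X]E<bK : (I + 4 * X) * E < b * K
  [I+4X]E<bK = *-cancelʳ-< D _ _ (begin-strict
    (I + 4 * X) * E * D              ≡⟨ solve 4 (λ I x e d → (I :+ con 4 :* x) :* e :* d := I :* d :* e :+ d :* e :* (con 4 :* x)) refl I X E D ⟩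
    I * D * E + D * E * (4 * X)      ≤⟨ +-monoˡ-≤ _ (*-monoˡ-≤ E ID≤aK+D) ⟩
    (a * K + D) * E + D * E * (4 * X) ≡⟨ solve 5 (λ a K d e y → (a :* K :+ d) :* e :+ d :* e :* y := a :* e :* K :+ d :* e :* (con 1 :+ y)) refl a K D E (4 * X) ⟩
    a * E * K + D * E * (1 + 4 * X)  <⟨ +-monoʳ-< (a * E * K) error<K ⟩
    a * E * K + K                    ≡⟨ +-comm (a * E * K) K ⟩
    suc (a * E) * K                  ≤⟨ *-monoˡ-≤ K aE<bD ⟩
    b * D * K                        ≡⟨ solve 3 (λ b d K → b :* d :* K := b :* K :* d) refl b D K ⟩
    b * K * D                        ∎)
    where open ≤-Reasoning

3*2^≢0 : ∀ j → NonZero (3 * 2 ^ j)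
3*2^≢0 j = m*n≢0 3 (2 ^ j) {{_}} {{m^n≢0 2 j}}

infix 25 _/[3·2^_]
_/[3·2^_] : ℕ → ℕ → ℚ
a /[3·2^ j ] = ((+ a) / (3 * 2 ^ j)) {{3*2^≢0 j}}

GridPointBetween : ℚ → ℚ → Set
GridPointBetween p q = Σ ℕ λ i → Σ ℕ λ I → p ℚ.< I /[3·2^ (2 * i) ] × (I + 4 * 2 ^ i) /[3·2^ (2 * i) ] ℚ.< q

grid-between : ∀ {p q} → ¬ p ℚ.< 0ℚ → p ℚ.< q → GridPointBetween p q
grid-between {p} {q} p≮0 p<q =
  from-fractions (nonNegative⇒fraction p p≮0) (nonNegative⇒fraction q (λ q<0 → p≮0 (ℚP.<-trans p<q q<0)))
  where
  from-fractions : (Σ ℕ λ a → Σ ℕ λ d → p ≡ (+ a) / suc d) → (Σ ℕ λ b → Σ ℕ λ e → q ≡ (+ b) / suc e) →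
                   GridPointBetween p q
  from-fractions (a , d , p≡a/d) (b , e , q≡b/e) =
    refine (grid-between-ℕ a (suc d) b (suc e) (fraction-<⁻ a b (suc d) (suc e) (subst₂ ℚ._<_ p≡a/d q≡b/e p<q)))
    where
    refine : (Σ ℕ λ i → Σ ℕ λ I → a * (3 * 2 ^ (2 * i)) < I * suc d × (I + 4 * 2 ^ i) * suc e < b * (3 * 2 ^ (2 * i))) →
             GridPointBetween p q
    refine (i , I , below , above) =
      i , I , subst (ℚ._< I /[3·2^ (2 * i) ]) (sym p≡a/d)
                (fraction-<⁺ a I (suc d) (3 * 2 ^ (2 * i)) {{_}} {{3*2^≢0 (2 * i)}} below)
            , subst ((I + 4 * 2 ^ i) /[3·2^ (2 * i) ] ℚ.<_) (sym q≡b/e)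
                (fraction-<⁺ (I + 4 * 2 ^ i) b (3 * 2 ^ (2 * i)) (suc e) {{3*2^≢0 (2 * i)}} above)

4^i≡2^[2i] : ∀ i → 4 ^ i ≡ 2 ^ (2 * i)
4^i≡2^[2i] i = ^-*-assoc 2 2 i

sparseResidues : ℕ → List ℕ
sparseResidues i = applyDownFrom (spread i) (2 ^ i) ++ applyDownFrom (λ z → 2 * spread i z) (2 ^ i)

sparseResidues-< : ∀ i → All (_< 2 ^ (2 * i)) (sparseResidues i)
sparseResidues-< i = Allₚ.++⁺ (Allₚ.applyDownFrom⁺₂ (spread i) (2 ^ i) (λ z → ≤-<-trans (m≤n*m (spread i z) 3) (3*spread< z)))
                              (Allₚ.applyDownFrom⁺₂ _ (2 ^ i) (λ z → ≤-<-trans (*-monoˡ-≤ (spread i z) (n≤1+n 2)) (3*spread< z)))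
  where
  3*spread< : ∀ z → 3 * spread i z < 2 ^ (2 * i)
  3*spread< z = subst (3 * spread i z <_) (4^i≡2^[2i] i) (spread-< i z)

length-sparseResidues : ∀ i → length (sparseResidues i) ≡ 2 ^ i + 2 ^ i
length-sparseResidues i = trans (length-++ (applyDownFrom (spread i) (2 ^ i)))
                            (cong₂ _+_ (length-applyDownFrom _ (2 ^ i)) (length-applyDownFrom _ (2 ^ i)))

MoserDeBruijn-residue : ∀ i {u} → MoserDeBruijn u → Σ ℕ λ z → Σ ℕ λ w → z < 2 ^ i × u ≡ spread i z + 2 ^ (2 * i) * w
MoserDeBruijn-residue i (i′ , z , refl) with spread-mod i′ i z
... | z′ , w , z′< , eq = z′ , w , z′< , trans eq (cong (λ N → spread i z′ + N * w) (4^i≡2^[2i] i))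

MoserDeBruijn⊆sparse : ∀ i {u} → MoserDeBruijn u → InResidues (2 ^ (2 * i)) (sparseResidues i) u
MoserDeBruijn⊆sparse i E-u with MoserDeBruijn-residue i E-u
... | z , w , z< , eq = Anyₚ.++⁺ˡ (Anyₚ.applyDownFrom⁺ (spread i) (w , eq) z<)

2*MoserDeBruijn⊆sparse : ∀ i {e} → MoserDeBruijn e → InResidues (2 ^ (2 * i)) (sparseResidues i) (2 * e)
2*MoserDeBruijn⊆sparse i E-e with MoserDeBruijn-residue i E-e
... | z , w , z< , refl = Anyₚ.++⁺ʳ (applyDownFrom (spread i) (2 ^ i)) (Anyₚ.applyDownFrom⁺ _ (2 * w ,
  solve 3 (λ s N w → con 2 :* (s :+ N :* w) := con 2 :* s :+ N :* (con 2 :* w)) refl (spread i z) (2 ^ (2 * i)) w) z<)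

Q⊆sparse : ∀ i {u} → Q u → InResidues (2 ^ (2 * i)) (sparseResidues i) u ⊎ u < 2 * 2 ^ (2 * i)
Q⊆sparse i (k , e , E-e , 2e<4^k , refl) with i ≤? 3 * k | MoserDeBruijn-residue i E-e
... | yes i≤3k | z , w , z< , refl =
  inj₁ (Anyₚ.++⁺ʳ (applyDownFrom (spread i) (2 ^ i)) (Anyₚ.applyDownFrom⁺ _ (4 ^ d + 2 * w , eq) z<))
  where
  N = 2 ^ (2 * i)
  d = proj₁ (m≤n⇒∃[o]m+o≡n i≤3k)
  4^3k≡N*4^d : 4 ^ (3 * k) ≡ N * 4 ^ d
  4^3k≡N*4^d = begin
    4 ^ (3 * k)      ≡⟨ cong (4 ^_) (sym (proj₂ (m≤n⇒∃[o]m+o≡n i≤3k))) ⟩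
    4 ^ (i + d)      ≡⟨ ^-distribˡ-+-* 4 i d ⟩
    4 ^ i * 4 ^ d    ≡⟨ cong (_* 4 ^ d) (4^i≡2^[2i] i) ⟩
    N * 4 ^ d        ∎
    where open ≡-Reasoning
  eq : 4 ^ (3 * k) + 2 * (spread i z + N * w) ≡ 2 * spread i z + N * (4 ^ d + 2 * w)
  eq = trans (cong (_+ 2 * (spread i z + N * w)) 4^3k≡N*4^d)
             (solve 4 (λ N p s w → N :* p :+ con 2 :* (s :+ N :* w) := con 2 :* s :+ N :* (p :+ con 2 :* w)) refl N (4 ^ d) (spread i z) w)
... | no i≰3k | _ = inj₂ (begin-strict
  4 ^ (3 * k) + 2 * e         <⟨ +-monoʳ-< (4 ^ (3 * k)) 2e<4^k ⟩
  4 ^ (3 * k) + 4 ^ k         ≤⟨ +-monoʳ-≤ (4 ^ (3 * k)) (^-monoʳ-≤ 4 (m≤n*m k 3)) ⟩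
  4 ^ (3 * k) + 4 ^ (3 * k)   ≡⟨ solve 1 (λ x → x :+ x := con 2 :* x) refl (4 ^ (3 * k)) ⟩
  2 * 4 ^ (3 * k)             ≤⟨ *-monoʳ-≤ 2 (subst (4 ^ (3 * k) ≤_) (4^i≡2^[2i] i) (^-monoʳ-≤ 4 (<⇒≤ (≰⇒> i≰3k)))) ⟩
  2 * 2 ^ (2 * i)             ∎)
  where open ≤-Reasoning

revResidues : ℕ → ℕ → List ℕ
revResidues J I = applyDownFrom (rev J) I

rev-<⇒revResidues : ∀ J {I u} → rev J u < I → InResidues (2 ^ J) (revResidues J I) u
rev-<⇒revResidues J {u = u} rev<I = Anyₚ.applyDownFrom⁺ (rev J) (high J u , rev-rev-high J u) rev<I

revResidues⇒rev-< : ∀ J {I u} → I ≤ 2 ^ J → InResidues (2 ^ J) (revResidues J I) u → rev J u < I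
revResidues⇒rev-< J I≤2^J p with Anyₚ.applyDownFrom⁻ (rev J) p
... | x , x<I , (t , refl) = subst (_< _) (sym (trans (rev-mod J (rev J x) t) (rev-involutive J x (<-≤-trans x<I I≤2^J)))) x<I

revResidues-distinct : ∀ J {I} → I ≤ 2 ^ J → AllPairs _≢_ (revResidues J I)
revResidues-distinct J {I} I≤2^J = AllPairsₚ.applyDownFrom⁺₁ (rev J) I
  λ {x} {y} y<x x<I rev-x≡rev-y → <-irrefl (sym (trans (sym (rev-involutive J x (<-≤-trans x<I I≤2^J)))
                                         (trans (cong (rev J) rev-x≡rev-y) (rev-involutive J y (<-≤-trans (<-trans y<x x<I) I≤2^J))))) y<x

module BuckDensityOfA (α : ℝ) (0≤α : 0ℚ ≤ℝ α) (α<¼ : α ℝ< (+ 1 / 4)) where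

  -- rev j m / 2^j increases with j (rev-prefix) up to the van der Corput value vdC(m), so this
  -- is the set {m : vdC(m) < 3α}.
  VdC<3α : SubsetNat
  VdC<3α m = ∀ j → rev j m /[3·2^ j ] <ℝ α

  open SumSet VdC<3α public

  rev-<⇒VdC<3α : ∀ J {I u} → I /[3·2^ J ] <ℝ α → rev J u < I → VdC<3α u
  rev-<⇒VdC<3α J {I} {u} I/K<α rev<I j =
    L-lower α (fraction-<⁺ (rev j u) I (3 * 2 ^ j) (3 * 2 ^ J) {{3*2^≢0 j}} {{3*2^≢0 J}} cross) I/K<α
    where
    cross : rev j u * (3 * 2 ^ J) < I * (3 * 2 ^ j)
    cross = begin-strict
      rev j u * (3 * 2 ^ J)    ≡⟨ solve 2 (λ r p → r :* (con 3 :* p) := con 3 :* (r :* p)) refl (rev j u) (2 ^ J) ⟩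
      3 * (rev j u * 2 ^ J)    <⟨ *-monoʳ-< 3 (rev-prefix j J u) ⟩
      3 * (suc (rev J u) * 2 ^ j) ≤⟨ *-monoʳ-≤ 3 (*-monoˡ-≤ (2 ^ j) rev<I) ⟩
      3 * (I * 2 ^ j)          ≡⟨ solve 2 (λ I p → con 3 :* (I :* p) := I :* (con 3 :* p)) refl I (2 ^ j) ⟩
      I * (3 * 2 ^ j)          ∎
      where open ≤-Reasoning

  VdC<3α⇒rev-< : ∀ J {I u} → α ℝ< I /[3·2^ J ] → VdC<3α u → rev J u < I
  VdC<3α⇒rev-< J {I} {u} α<I/K vdc = ≰⇒> λ I≤rev → disjoint α (vdc J , U-upper-≤ α α<I/K
    (fraction-≤⁺ I (rev J u) (3 * 2 ^ J) (3 * 2 ^ J) {{3*2^≢0 J}} {{3*2^≢0 J}} (*-monoˡ-≤ (3 * 2 ^ J) I≤rev)))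

  innerCode : ℕ → ℕ → ZCode
  innerCode J I = progressions (3 * 2 ^ J) (map (3 *_) (revResidues J I))

  innerCode⊆A : ∀ J {I} → I ≤ 2 ^ J → I /[3·2^ J ] <ℝ α → ⟦ innerCode J I ⟧ ⊆ A
  innerCode⊆A J I≤2^J I/K<α n p =
    let u , n≡3u , q = affine-residues⁻ 3 0 {N = 2 ^ J} (Anyₚ.map⁻ p)
    in  inj₁ (u , n≡3u , inj₁ (rev-<⇒VdC<3α J I/K<α (revResidues⇒rev-< J I≤2^J q)))

  innerCode-density : ∀ J {I} → I ≤ 2 ^ J → ZDensity (innerCode J I) (I /[3·2^ J ])
  innerCode-density J {I} I≤2^J =
    subst (λ W → ZDensity (innerCode J I) (W /[3·2^ J ])) count≡I (progressions-density {{3*2^≢0 J}} residues<K)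
    where
    residues<K : All (_< 3 * 2 ^ J) (map (3 *_) (revResidues J I))
    residues<K = Allₚ.map⁺ (Allₚ.applyDownFrom⁺₂ (rev J) I (λ x → *-monoʳ-< 3 (rev-< J x)))
    residues-distinct : AllPairs _≢_ (map (3 *_) (revResidues J I))
    residues-distinct = AllPairsₚ.map⁺ (AllPairs.map (λ x≢y 3x≡3y → x≢y (*-cancelˡ-≡ _ _ 3 3x≡3y)) (revResidues-distinct J I≤2^J))
    count≡I : residueCount (3 * 2 ^ J) (map (3 *_) (revResidues J I)) ≡ I
    count≡I = trans (residueCount-≡ {{3*2^≢0 J}} residues-distinct residues<K)
                    (trans (length-map (3 *_) (revResidues J I)) (length-applyDownFrom (rev J) I))

  outerResidues : ℕ → ℕ → List ℕ
  outerResidues i I = map (3 *_) (revResidues (2 * i) I ++ sparseResidues i) ++ map (λ r → 1 + 3 * r) (sparseResidues i)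

  outerCode : ℕ → ℕ → ZCode
  outerCode i I = progressions (3 * 2 ^ (2 * i)) (outerResidues i I) ++ segment (6 * 2 ^ (2 * i))

  module _ (i I : ℕ) where

    private
      N = 2 ^ (2 * i)

      class₀ : ∀ {u} → InResidues N (revResidues (2 * i) I ++ sparseResidues i) u → ⟦ outerCode i I ⟧ (3 * u)
      class₀ p = Anyₚ.++⁺ˡ (Anyₚ.map⁺ (Anyₚ.++⁺ˡ {xs = map (3 *_) (revResidues (2 * i) I ++ sparseResidues i)}
                                                (affine-residues 3 0 {N} p)))

      class₁ : ∀ {u} → InResidues N (sparseResidues i) u ⊎ u < 2 * N → ⟦ outerCode i I ⟧ (1 + 3 * u)
      class₁ (inj₁ p)    = Anyₚ.++⁺ˡ (Anyₚ.map⁺ (Anyₚ.++⁺ʳ (map (3 *_) (revResidues (2 * i) I ++ sparseResidues i))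
                                                           (affine-residues 3 1 {N} p)))
      class₁ {u} (inj₂ u<2N) = Anyₚ.++⁺ʳ (progressions (3 * N) (outerResidues i I)) (segment⁺ (begin
        1 + 3 * u    ≤⟨ +-monoˡ-≤ (3 * u) (s≤s (z≤n {2})) ⟩
        3 + 3 * u    ≡⟨ sym (*-suc 3 u) ⟩
        3 * suc u    ≤⟨ *-monoʳ-≤ 3 u<2N ⟩
        3 * (2 * N)  ≡⟨ sym (*-assoc 3 2 N) ⟩
        6 * N        ∎))
        where open ≤-Reasoning

    A⊆outerCode : α ℝ< I /[3·2^ (2 * i) ] → A ⊆ ⟦ outerCode i I ⟧
    A⊆outerCode α<I/K n (inj₁ (u , refl , inj₁ vdc)) =
      class₀ (Anyₚ.++⁺ˡ (rev-<⇒revResidues (2 * i) (VdC<3α⇒rev-< (2 * i) {I} α<I/K vdc)))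
    A⊆outerCode α<I/K n (inj₁ (u , refl , inj₂ (inj₁ E-u))) =
      class₀ (Anyₚ.++⁺ʳ (revResidues (2 * i) I) (MoserDeBruijn⊆sparse i E-u))
    A⊆outerCode α<I/K n (inj₁ (u , refl , inj₂ (inj₂ (e , refl , E-e)))) =
      class₀ (Anyₚ.++⁺ʳ (revResidues (2 * i) I) (2*MoserDeBruijn⊆sparse i E-e))
    A⊆outerCode α<I/K n (inj₂ (u , refl , inj₁ E-u)) = class₁ (inj₁ (MoserDeBruijn⊆sparse i E-u))
    A⊆outerCode α<I/K n (inj₂ (u , refl , inj₂ Q-u)) = class₁ (Q⊆sparse i Q-u)

    outerResidues-< : All (_< 3 * N) (outerResidues i I)
    outerResidues-< = Allₚ.++⁺ (Allₚ.map⁺ (Allₚ.++⁺ (Allₚ.applyDownFrom⁺₂ (rev (2 * i)) I (λ x → *-monoʳ-< 3 (rev-< (2 * i) x)))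
                                                     (All.map (*-monoʳ-< 3) (sparseResidues-< i))))
                               (Allₚ.map⁺ (All.map (affine-< {3} {1} (s≤s (s≤s z≤n))) (sparseResidues-< i)))

    length-outerResidues : length (outerResidues i I) ≡ I + 4 * 2 ^ i
    length-outerResidues = begin
      length (outerResidues i I)                                     ≡⟨ length-++ (map (3 *_) (revResidues (2 * i) I ++ sparseResidues i)) ⟩
      length (map (3 *_) (revResidues (2 * i) I ++ sparseResidues i))
        + length (map (λ r → 1 + 3 * r) (sparseResidues i))         ≡⟨ cong₂ _+_ (length-map (3 *_) (revResidues (2 * i) I ++ _)) (length-map _ (sparseResidues i)) ⟩
      length (revResidues (2 * i) I ++ sparseResidues i)
        + length (sparseResidues i)                                  ≡⟨ cong (_+ length (sparseResidues i)) (length-++ (revResidues (2 * i) I)) ⟩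
      length (revResidues (2 * i) I) + length (sparseResidues i)
        + length (sparseResidues i)                                  ≡⟨ cong₂ (λ a b → a + b + b) (length-applyDownFrom (rev (2 * i)) I) (length-sparseResidues i) ⟩
      I + (2 ^ i + 2 ^ i) + (2 ^ i + 2 ^ i)                          ≡⟨ solve 2 (λ I x → I :+ (x :+ x) :+ (x :+ x) := I :+ con 4 :* x) refl I (2 ^ i) ⟩
      I + 4 * 2 ^ i                                                  ∎
      where open ≡-Reasoning

    outerCode-density : Σ ℕ λ W → W ≤ I + 4 * 2 ^ i × ZDensity (outerCode i I) (W /[3·2^ (2 * i) ])
    outerCode-density = residueCount (3 * N) (outerResidues i I)
                      , ≤-trans (residueCount-≤ outerResidues-<) (≤-reflexive length-outerResidues)
                      , progressions-segment-density {{3*2^≢0 (2 * i)}} outerResidues-< (6 * N)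

  private
    grid-≤ : ∀ i I → I /[3·2^ (2 * i) ] ℚ.≤ (I + 4 * 2 ^ i) /[3·2^ (2 * i) ]
    grid-≤ i I = fraction-≤⁺ I (I + 4 * 2 ^ i) (3 * 2 ^ (2 * i)) (3 * 2 ^ (2 * i)) {{3*2^≢0 (2 * i)}} {{3*2^≢0 (2 * i)}}
                   (*-monoˡ-≤ (3 * 2 ^ (2 * i)) (m≤m+n I (4 * 2 ^ i)))

  grid⇒inner : ∀ {r r₁} → r₁ <ℝ α → GridPointBetween r r₁ → InnerApproximation A r
  grid⇒inner {r} {r₁} r₁<α (i , I , r<I/K , [I+4X]/K<r₁) =
    innerCode (2 * i) I , I /[3·2^ (2 * i) ] , innerCode⊆A (2 * i) I≤N I/K<α , innerCode-density (2 * i) I≤N , r<I/K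
    where
    I/K<r₁ : I /[3·2^ (2 * i) ] ℚ.< r₁
    I/K<r₁ = ℚP.≤-<-trans (grid-≤ i I) [I+4X]/K<r₁
    I/K<α : I /[3·2^ (2 * i) ] <ℝ α
    I/K<α = L-lower α I/K<r₁ r₁<α
    I≤N : I ≤ 2 ^ (2 * i)
    I≤N = <⇒≤ (*-cancelʳ-< 4 I (2 ^ (2 * i)) (begin-strict
      I * 4                 <⟨ fraction-<⁻ I 1 (3 * 2 ^ (2 * i)) 4 {{3*2^≢0 (2 * i)}} (ℚP.<-trans I/K<r₁ (L<U α r₁<α α<¼)) ⟩
      1 * (3 * 2 ^ (2 * i)) ≤⟨ ≤-reflexive (*-identityˡ _) ⟩
      3 * 2 ^ (2 * i)       ≤⟨ *-monoˡ-≤ (2 ^ (2 * i)) (n≤1+n 3) ⟩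
      4 * 2 ^ (2 * i)       ≡⟨ *-comm 4 (2 ^ (2 * i)) ⟩
      2 ^ (2 * i) * 4       ∎))
      where open ≤-Reasoning

  grid⇒outer : ∀ {r r₁} → α ℝ< r₁ → GridPointBetween r₁ r → OuterApproximation A r
  grid⇒outer {r} {r₁} α<r₁ (i , I , r₁<I/K , [I+4X]/K<r) =
    let W , W≤I+4X , density = outerCode-density i I
    in  outerCode i I , W /[3·2^ (2 * i) ] , A⊆outerCode i I (U-upper α r₁<I/K α<r₁) , density ,
        ℚP.≤-<-trans (fraction-≤⁺ W (I + 4 * 2 ^ i) (3 * 2 ^ (2 * i)) (3 * 2 ^ (2 * i)) {{3*2^≢0 (2 * i)}} {{3*2^≢0 (2 * i)}}
                       (*-monoˡ-≤ (3 * 2 ^ (2 * i)) W≤I+4X)) [I+4X]/K<r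

  inner-approximation : ∀ r → r <ℝ α → InnerApproximation A r
  inner-approximation r r<α = case-sign (r ℚP.<? 0ℚ)
    where
    case-sign : Dec (r ℚ.< 0ℚ) → InnerApproximation A r
    case-sign (yes r<0) = [] , 0ℚ , (λ _ ()) , progressions-density {K = 1} {rs = []} [] , r<0
    case-sign (no r≮0)  = let r₁ , r<r₁ , r₁<α = L-open α r<α in grid⇒inner r₁<α (grid-between r≮0 r<r₁)

  outer-approximation : ∀ r → α ℝ< r → OuterApproximation A r
  outer-approximation r α<r =
    let r₁ , r₁<r , α<r₁ = U-open α α<r
    in  grid⇒outer α<r₁ (grid-between (λ r₁<0 → 0≤α (U-upper α r₁<0 α<r₁)) r₁<r)

  A-hasBuckDensity : HasBuckDensity A α
  A-hasBuckDensity = hasBuckDensity {A} {α} inner-approximation outer-approximation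

theorem1p3 : ∀ (α : ℝ) → 0ℚ ≤ℝ α → α ℝ< (+ 1 / 4) →
    Σ SubsetNat λ A → HasBuckDensity A α ×
      Σ ℝ λ β → Σ ℝ λ γ → IsLowerBuck (A ⊕ A) β × IsUpperBuck (A ⊕ A) γ × ¬ (β ≈ℝ γ)
theorem1p3 α 0≤α α<¼ =
  A , A-hasBuckDensity , fromℚ (+ 2 / 3) , fromℚ 1ℚ , A⊕A-lowerBuck , A⊕A-upperBuck ,
  fromℚ-<⇒≉ (fraction-<⁺ 2 1 3 1 (s≤s (s≤s (s≤s z≤n))))
  where open BuckDensityOfA α 0≤α α<¼
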